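{- Given a reactantless reaction system $\mathcal{A}=(S,A)\in\mathcal{RS}(0,\infty)$, it can be decided in polynomial time whether $\mathrm{res}_{\mathcal{A}}:2^S\to 2^S$ is bijective.
   Context: A reaction over a finite set $S$ is a triple $a=(R_a,I_a,P_a)$ of subsets of $S$ (reactants, inhibitors, products) with $P_a\neq\varnothing$. A reaction system is a pair $\mathcal{A}=(S,A)$ with $S$ a finite background set and $A$ a set of reactions over $S$. A reaction $a$ is enabled in a state $T\subseteq S$ if $R_a\subseteq T$ and $I_a\cap T=\varnothing$. The result function is $\mathrm{res}_{\mathcal{A}}(T)=\bigcup\{P_a : a\in A \text{ enabled in } T\}$. $\mathcal{RS}(0,\infty)$ (reactantless systems) is the class of reaction systems in which every reaction has $R_a=\varnothing$. The input is given by explicitly listing $S$ and the reactions. -}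

module Defs where

open import Data.Nat using (ℕ; zero; suc; _+_; _*_; _^_; _≤_)
open import Data.Bool using (Bool; true; false)
open import Data.Fin using (Fin) renaming (zero to fz; suc to fs)
open import Data.Fin.Subset using (Subset; _⊆_; _∩_; _∪_; ⊥; ⋃; Nonempty; Empty; inside; outside)
open import Data.Fin.Subset.Properties using (_⊆?_; nonempty?)
open import Data.List using (List; []; _∷_; map; filter; length; _++_; concatMap; replicate)
open import Data.Vec using (Vec; []; _∷_)
open import Data.Product using (Σ; _×_; _,_; proj₁; proj₂; ∃)
open import Data.Sum using (_⊎_; inj₁; inj₂)
open import Relation.Nullary using (Dec; ¬?)
open import Relation.Nullary.Decidable using (_×-dec_)
open import Relation.Binary.PropositionalEquality using (_≡_)
open import Data.List.Membership.Propositional using () renaming (_∈_ to _∈ₗ_)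
open import Function.Definitions using (Bijective)

record Reaction (n : ℕ) : Set where
  field
    R I P    : Subset n
    P-nonempty : Nonempty P

open Reaction public

record RS : Set where
  constructor rs
  field
    size      : ℕ
    reactions : List (Reaction size)

open RS public

Enabled : ∀ {n} → Reaction n → Subset n → Set
Enabled a T = (R a ⊆ T) × Empty (I a ∩ T)

enabled? : ∀ {n} (T : Subset n) (a : Reaction n) → Dec (Enabled a T)
enabled? T a = (R a ⊆? T) ×-dec ¬? (nonempty? (I a ∩ T))

res : (𝒜 : RS) → Subset (size 𝒜) → Subset (size 𝒜)
res 𝒜 T = ⋃ (map P (filter (enabled? T) (reactions 𝒜)))

Reactantless : RS → Set
Reactantless 𝒜 = ∀ a → a ∈ₗ reactions 𝒜 → R a ≡ ⊥

ResBijective : RS → Set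
ResBijective 𝒜 = Bijective _≡_ _≡_ (res 𝒜)

data InSym : Set where
  𝟎 𝟏 ♯ : InSym

bits : ∀ {n} → Subset n → List InSym
bits []            = []
bits (inside ∷ p)  = 𝟏 ∷ bits p
bits (outside ∷ p) = 𝟎 ∷ bits p

encReaction : ∀ {n} → Reaction n → List InSym
encReaction a = bits (R a) ++ ♯ ∷ bits (I a) ++ ♯ ∷ bits (P a) ++ ♯ ∷ []

encode : RS → List InSym
encode 𝒜 = replicate (size 𝒜) 𝟏 ++ ♯ ∷ concatMap encReaction (reactions 𝒜)

-- Tape alphabet: Fin (4 + g); 0 is the blank, 1,2,3 are 𝟎,𝟏,♯.
-- Working states: Fin (suc q), state zero is the start state.
-- Halting states: inj₂ b (b = true: accept, false: reject).

data Move : Set where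
  L R' Stay : Move

Sym : ℕ → Set
Sym g = Fin (4 + g)

State : ℕ → Set
State q = Fin (suc q) ⊎ Bool

record TM : Set where
  field
    q g : ℕ
    δ   : Fin (suc q) → Sym g → State q × Sym g × Move

open TM public

blank : ∀ {g} → Sym g
blank = fz

embed : ∀ {g} → InSym → Sym g
embed 𝟎 = fs fz
embed 𝟏 = fs (fs fz)
embed ♯ = fs (fs (fs fz))

-- configuration: state, tape left of head (nearest cell first),
-- scanned symbol, tape right of head; unwritten cells are blank.
record Config (M : TM) : Set where
  constructor ⟨_,_,_,_⟩
  field
    state : State (q M)
    left  : List (Sym (g M))
    head  : Sym (g M)
    right : List (Sym (g M))

open Config public

initial : (M : TM) → List InSym → Config M
initial M []       = ⟨ inj₁ fz , [] , blank , [] ⟩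
initial M (x ∷ xs) = ⟨ inj₁ fz , [] , embed x , map embed xs ⟩

step : (M : TM) → Config M → Config M
step M c@(⟨ inj₂ b , l , h , r ⟩) = c
step M ⟨ inj₁ s , l , h , r ⟩ with δ M s h
... | s' , w , Stay = ⟨ s' , l , w , r ⟩
... | s' , w , R' with r
...   | []     = ⟨ s' , w ∷ l , blank , [] ⟩
...   | x ∷ r' = ⟨ s' , w ∷ l , x , r' ⟩
step M ⟨ inj₁ s , l , h , r ⟩ | s' , w , L with l
...   | []     = ⟨ s' , [] , blank , w ∷ r ⟩
...   | x ∷ l' = ⟨ s' , l' , x , w ∷ r ⟩

run : (M : TM) → ℕ → Config M → Config M
run M zero    c = c
run M (suc t) c = run M t (step M c)

HaltsWithin : (M : TM) → List InSym → ℕ → Bool → Set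
HaltsWithin M w t b = state (run M t (initial M w)) ≡ inj₂ b

PolyTimeDecidable : (Class : RS → Set) (Prop : RS → Set) → Set
PolyTimeDecidable Class Prop =
  Σ TM λ M → Σ ℕ λ c → Σ ℕ λ d →
    ∀ 𝒜 → Class 𝒜 →
      Σ Bool λ b →
        HaltsWithin M (encode 𝒜) (c * length (encode 𝒜) ^ d + c) b
        × ((b ≡ true → Prop 𝒜) × (Prop 𝒜 → b ≡ true))

-- For a reactantless system, res T is the union of the products of the reactions whose inhibitors
-- avoid T, so res is antitone. Say that x controls z if some reaction with inhibitor set {x}
-- produces z. If every x controls exactly one z, and the controller of z inhibits every reaction
-- producing z, then res T = σ⁻¹ (S ∖ T) for the permutation σ mapping z to its controller, so res
-- is bijective. Conversely, if res is bijective then res S = ∅, so no inhibitor set is empty, and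
-- res (S ∖ {x}) is a singleton {π x} for a permutation π; induction on U along ⊂ gives
-- res (S ∖ U) = π[U], from which the conditions are read off.
--
-- The conditions are checked by a single-tape machine that only sweeps back and forth over the
-- input; each sweep runs a finite transducer over the tape, with a candidate pair (x, z) marked
-- on it. There are O(|S|²) sweeps of linear length, so the running time is cubic.

module Submission where

open import Defs
open import Data.Bool using (Bool; true; false; not; _∧_; _∨_; if_then_else_)
open import Data.Bool.Properties using (not-involutive; ∨-idem; ∨-identityʳ; ¬-not)
open import Data.Nat using (ℕ; zero; suc; _+_; _*_; _^_; _∸_; _≤_; _<_; _≡ᵇ_; pred; z≤n; s≤s)
import Data.Nat.Properties as ℕ
open import Data.Nat.Tactic.RingSolver using (solve-∀)
open import Data.Fin using (Fin; toℕ; fromℕ<; punchOut; combine; remQuot; splitAt; _↑ˡ_; _↑ʳ_)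
  renaming (zero to fz; suc to fs)
open import Data.Fin.Properties
  using ( any?; all?; ¬∀⟶∃¬; _≟_; injective⇒≤; punchOut-injective; toℕ-fromℕ<; toℕ-injective; toℕ<n
        ; remQuot-combine; splitAt-↑ˡ; splitAt-↑ʳ)
open import Data.Fin.Subset
  using (Subset; _∈_; _∉_; _⊆_; _⊂_; ∁; ⁅_⁆; ⊤; ⊥; inside; outside; ⋃; Nonempty)
open import Data.Fin.Subset.Properties
  using ( _∈?_; ∈⊤; ∉⊥; ⊆-antisym; x∈⁅x⁆; x∈⁅y⁆⇒x≡y; x∈p∪q⁺; x∈p∪q⁻; x∈p∩q⁺; x∈p∩q⁻
        ; x∈∁p⇒x∉p; x∉p⇒x∈∁p; x≢y⇒x∉⁅y⁆; p⊆q⇒∁p⊇∁q; ⊆⊤; nonempty?; Empty-unique)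
open import Data.Fin.Subset.Induction using (⊂-wellFounded; Acc; acc)
open import Data.Unit using (tt) renaming (⊤ to Unit)
open import Data.Empty using (⊥-elim) renaming (⊥ to 𝟘)
open import Data.Maybe using (Maybe; just; nothing)
open import Data.Vec using (Vec; []; _∷_; lookup; tabulate; here; there)
import Data.Vec as Vec
open import Data.Vec.Properties using ([]=⇒lookup; lookup⇒[]=; lookup∘tabulate)
open import Data.List using (List; []; _∷_; _++_; map; length; reverse; _ʳ++_; replicate; concatMap; foldl)
open import Data.List.Properties
  using (length-map; length-reverse; reverse-map; reverse-involutive; ʳ++-defn; ++-identityʳ; map-++; length-++; length-replicate)
open import Data.List.Membership.Propositional using () renaming (_∈_ to _∈ₗ_)
open import Data.List.Membership.Propositional.Properties using (∈-filter⁺; ∈-filter⁻; ∈-map⁺; ∈-map⁻)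
open import Data.List.Relation.Unary.Any using (here; there)
open import Data.List.Relation.Binary.Pointwise using (Pointwise; []; _∷_; Pointwise-length)
open import Data.Product using (∃-syntax; _×_; _,_; proj₁; proj₂)
open import Data.Sum using (_⊎_; inj₁; inj₂; [_,_]′)
open import Function using (_∘_; _∘′_; case_of_)
open import Function.Bundles using (Bijection; mk↔ₛ′)
open import Function.Properties.Inverse using (Inverse⇒Bijection)
open import Function.Definitions using (Injective; Bijective)
open import Relation.Nullary using (¬_; yes; no; contradiction)
open import Relation.Binary.PropositionalEquality
  using (_≡_; _≢_; refl; sym; trans; cong; cong₂; subst; subst₂; module ≡-Reasoning)

-- Bijectivity of res for reactantless systems

private
  variable
    k : ℕ

Fin-injective⇒surjective : {f : Fin k → Fin k} → Injective _≡_ _≡_ f → ∀ y → ∃[ x ] f x ≡ y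
Fin-injective⇒surjective {zero} f-inj ()
Fin-injective⇒surjective {suc k} {f} f-inj y with any? (λ x → f x ≟ y)
... | yes hit = hit
... | no miss = contradiction (injective⇒≤ squeezed-injective) ℕ.1+n≰n
  where
    y≢f : ∀ x → y ≢ f x
    y≢f x = miss ∘ (x ,_) ∘ sym
    squeezed : Fin (suc k) → Fin k
    squeezed x = punchOut (y≢f x)
    squeezed-injective : Injective _≡_ _≡_ squeezed
    squeezed-injective {x} {x′} = f-inj ∘ punchOut-injective (y≢f x) (y≢f x′)

∁-involutive : (p : Subset k) → ∁ (∁ p) ≡ p
∁-involutive []      = refl
∁-involutive (b ∷ p) = cong₂ _∷_ (not-involutive b) (∁-involutive p)

nonempty-⊆⁅⁆ : ∀ {p : Subset k} {x} → Nonempty p → p ⊆ ⁅ x ⁆ → p ≡ ⁅ x ⁆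
nonempty-⊆⁅⁆ {x = x} (y , y∈p) p⊆ = ⊆-antisym p⊆ λ z∈ →
  subst (_∈ _) (trans (x∈⁅y⁆⇒x≡y x (p⊆ y∈p)) (sym (x∈⁅y⁆⇒x≡y x z∈))) y∈p

⁅⁆-injective : {x y : Fin k} → ⁅ x ⁆ ≡ ⁅ y ⁆ → x ≡ y
⁅⁆-injective {x = x} {y} eq = x∈⁅y⁆⇒x≡y y (subst (x ∈_) eq (x∈⁅x⁆ x))

∈-⋃⁻ : ∀ {x} (ps : List (Subset k)) → x ∈ ⋃ ps → ∃[ p ] p ∈ₗ ps × x ∈ p
∈-⋃⁻ []       x∈ = ⊥-elim (∉⊥ x∈)
∈-⋃⁻ (p ∷ ps) x∈ with x∈p∪q⁻ p (⋃ ps) x∈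
... | inj₁ x∈p  = p , here refl , x∈p
... | inj₂ x∈ps with ∈-⋃⁻ ps x∈ps
...   | q , q∈ , x∈q = q , there q∈ , x∈q

∈-⋃⁺ : ∀ {x p} {ps : List (Subset k)} → p ∈ₗ ps → x ∈ p → x ∈ ⋃ ps
∈-⋃⁺ (here refl) x∈p = x∈p∪q⁺ (inj₁ x∈p)
∈-⋃⁺ (there p∈)  x∈p = x∈p∪q⁺ (inj₂ (∈-⋃⁺ p∈ x∈p))

preimage : (Fin k → Fin k) → Subset k → Subset k
preimage f p = tabulate (λ x → lookup p (f x))

∈-preimage⁺ : ∀ {f : Fin k → Fin k} {p x} → f x ∈ p → x ∈ preimage f p
∈-preimage⁺ {f = f} {p} {x} fx∈p = lookup⇒[]= x _ (trans (lookup∘tabulate _ x) ([]=⇒lookup fx∈p))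

∈-preimage⁻ : ∀ {f : Fin k → Fin k} {p x} → x ∈ preimage f p → f x ∈ p
∈-preimage⁻ {f = f} {p} {x} x∈ = lookup⇒[]= (f x) p (trans (sym (lookup∘tabulate _ x)) ([]=⇒lookup x∈))

preimage-inverse : ∀ {f g : Fin k → Fin k} → (∀ x → g (f x) ≡ x) → ∀ p → preimage f (preimage g p) ≡ p
preimage-inverse {f = f} {g} gf p = ⊆-antisym
  (λ {x} x∈ → subst (_∈ p) (gf x) (∈-preimage⁻ (∈-preimage⁻ x∈)))
  (λ {x} x∈ → ∈-preimage⁺ (∈-preimage⁺ (subst (_∈ p) (sym (gf x)) x∈)))

preimage∘∁-bijective : ∀ {σ π : Fin k → Fin k} → (∀ x → σ (π x) ≡ x) → (∀ z → π (σ z) ≡ z) →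
                     (F : Subset k → Subset k) → (∀ T → F T ≡ preimage σ (∁ T)) →
                     Bijective _≡_ _≡_ F
preimage∘∁-bijective {σ = σ} {π} σπ πσ F F≡ =
  Bijection.bijective (Inverse⇒Bijection (mk↔ₛ′ F (λ V → ∁ (preimage π V)) F∘from from∘F))
  where
    open ≡-Reasoning
    F∘from : ∀ V → F (∁ (preimage π V)) ≡ V
    F∘from V = begin
      F (∁ (preimage π V))                ≡⟨ F≡ (∁ (preimage π V)) ⟩
      preimage σ (∁ (∁ (preimage π V)))   ≡⟨ cong (preimage σ) (∁-involutive (preimage π V)) ⟩
      preimage σ (preimage π V)           ≡⟨ preimage-inverse πσ V ⟩
      V                                   ∎
    from∘F : ∀ T → ∁ (preimage π (F T)) ≡ T
    from∘F T = begin
      ∁ (preimage π (F T))                ≡⟨ cong (∁ ∘ preimage π) (F≡ T) ⟩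
      ∁ (preimage π (preimage σ (∁ T)))   ≡⟨ cong ∁ (preimage-inverse σπ (∁ T)) ⟩
      ∁ (∁ T)                             ≡⟨ ∁-involutive T ⟩
      T                                   ∎

enabled⇒inhibitors⊆∁ : ∀ {a : Reaction k} {T} → Enabled a T → I a ⊆ ∁ T
enabled⇒inhibitors⊆∁ (_ , empty) x∈I = x∉p⇒x∈∁p λ x∈T → empty (_ , x∈p∩q⁺ (x∈I , x∈T))

inhibitors⊆∁⇒enabled : ∀ {a : Reaction k} {T} → R a ≡ ⊥ → I a ⊆ ∁ T → Enabled a T
inhibitors⊆∁⇒enabled {a = a} R≡⊥ I⊆∁T =
  (λ x∈R → ⊥-elim (∉⊥ (subst (_ ∈_) R≡⊥ x∈R))) ,
  λ (_ , x∈I∩T) → let x∈I , x∈T = x∈p∩q⁻ (I a) _ x∈I∩T in x∈∁p⇒x∉p (I⊆∁T x∈I) x∈T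

∈-res⁻ : ∀ 𝒜 {T z} → z ∈ res 𝒜 T → ∃[ a ] a ∈ₗ reactions 𝒜 × I a ⊆ ∁ T × z ∈ P a
∈-res⁻ 𝒜 {T} z∈ with ∈-⋃⁻ _ z∈
... | _ , p∈ , z∈p with ∈-map⁻ P p∈
...   | a , a∈ , refl with ∈-filter⁻ (enabled? T) {xs = reactions 𝒜} a∈
...     | a∈A , enabled = a , a∈A , enabled⇒inhibitors⊆∁ {a = a} {T} enabled , z∈p

Controls : (𝒜 : RS) → Fin (size 𝒜) → Fin (size 𝒜) → Set
Controls 𝒜 x z = ∃[ a ] a ∈ₗ reactions 𝒜 × I a ≡ ⁅ x ⁆ × z ∈ P a

-- `inhibited` follows from the other fields; it is kept because the decision procedure checks it.
record Criterion (𝒜 : RS) : Set where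
  field
    inhibited           : ∀ {a} → a ∈ₗ reactions 𝒜 → Nonempty (I a)
    controls            : ∀ x → ∃[ z ] Controls 𝒜 x z
    controls-unique     : ∀ {x z z′} → Controls 𝒜 x z → Controls 𝒜 x z′ → z ≡ z′
    controller-inhibits : ∀ {x z a} → Controls 𝒜 x z → a ∈ₗ reactions 𝒜 → z ∈ P a → x ∈ I a

module _ {𝒜 : RS} (reactantless : Reactantless 𝒜) where

  ∈-res⁺ : ∀ {a T z} → a ∈ₗ reactions 𝒜 → I a ⊆ ∁ T → z ∈ P a → z ∈ res 𝒜 T
  ∈-res⁺ {a} {T} a∈ I⊆∁T z∈P =
    ∈-⋃⁺ (∈-map⁺ P (∈-filter⁺ (enabled? T) a∈ (inhibitors⊆∁⇒enabled {a = a} {T} (reactantless a a∈) I⊆∁T))) z∈P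

  res-antitone : ∀ {T T′ : Subset (size 𝒜)} → T ⊆ T′ → res 𝒜 T′ ⊆ res 𝒜 T
  res-antitone T⊆T′ z∈ with ∈-res⁻ 𝒜 z∈
  ... | a , a∈ , I⊆∁T′ , z∈P = ∈-res⁺ a∈ (p⊆q⇒∁p⊇∁q T⊆T′ ∘ I⊆∁T′) z∈P

  criterion⇒bijective : Criterion 𝒜 → ResBijective 𝒜
  criterion⇒bijective crit = preimage∘∁-bijective σπ πσ (res 𝒜) res≡
    where
      open Criterion crit
      π : Fin (size 𝒜) → Fin (size 𝒜)
      π x = proj₁ (controls x)
      π-injective : Injective _≡_ _≡_ π
      π-injective {x} {x′} πx≡πx′ with controls x′
      ... | _ , a′ , a′∈ , I≡ , z∈P =
        x∈⁅y⁆⇒x≡y x′ (subst (x ∈_) I≡ (controller-inhibits (subst (Controls 𝒜 x) πx≡πx′ (proj₂ (controls x))) a′∈ z∈P))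
      σ : Fin (size 𝒜) → Fin (size 𝒜)
      σ z = proj₁ (Fin-injective⇒surjective π-injective z)
      πσ : ∀ z → π (σ z) ≡ z
      πσ z = proj₂ (Fin-injective⇒surjective π-injective z)
      σπ : ∀ x → σ (π x) ≡ x
      σπ x = π-injective (πσ (π x))
      σ-controls : ∀ z → Controls 𝒜 (σ z) z
      σ-controls z = subst (Controls 𝒜 (σ z)) (πσ z) (proj₂ (controls (σ z)))
      res≡ : ∀ T → res 𝒜 T ≡ preimage σ (∁ T)
      res≡ T = ⊆-antisym
        (λ z∈ → let _ , a∈ , I⊆∁T , z∈P = ∈-res⁻ 𝒜 z∈ in
                  ∈-preimage⁺ (I⊆∁T (controller-inhibits (σ-controls _) a∈ z∈P)))
        (λ {z} z∈ → let a , a∈ , I≡ , z∈P = σ-controls z in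
                  ∈-res⁺ a∈ (λ y∈I → subst (_∈ ∁ T) (sym (x∈⁅y⁆⇒x≡y _ (subst (_ ∈_) I≡ y∈I))) (∈-preimage⁻ z∈)) z∈P)

  module _ (bijective : ResBijective 𝒜) where

    private
      res-injective : ∀ {T T′} → res 𝒜 T ≡ res 𝒜 T′ → T ≡ T′
      res-injective = proj₁ bijective

      res-surjective : ∀ V → ∃[ T ] res 𝒜 T ≡ V
      res-surjective V = let T , onto = proj₂ bijective V in T , onto refl

    ∉-res-⊤ : ∀ {z} → z ∉ res 𝒜 ⊤
    ∉-res-⊤ z∈ = let T₀ , res≡⊥ = res-surjective ⊥ in ∉⊥ (subst (_ ∈_) res≡⊥ (res-antitone ⊆⊤ z∈))

    inhibitors-nonempty : ∀ {a} → a ∈ₗ reactions 𝒜 → Nonempty (I a)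
    inhibitors-nonempty {a} a∈ with nonempty? (I a)
    ... | yes nonempty = nonempty
    ... | no empty = ⊥-elim (∉-res-⊤ (∈-res⁺ a∈ (λ x∈I → ⊥-elim (empty (_ , x∈I))) (proj₂ (P-nonempty a))))

    -- Take T with res T = {z} and some x ∉ T: res (∁ {x}) ⊆ {z} by antitonicity, and it is not empty
    -- because res ⊤ = ∅ and res is injective.
    co-singleton : ∀ z → ∃[ x ] res 𝒜 (∁ ⁅ x ⁆) ≡ ⁅ z ⁆
    co-singleton z with res-surjective ⁅ z ⁆
    ... | T , resT≡ with all? (_∈? T)
    ...   | yes all∈T = ⊥-elim (∉-res-⊤ (res-antitone (λ {x} _ → all∈T x) (subst (z ∈_) (sym resT≡) (x∈⁅x⁆ z))))
    ...   | no ¬all∈T = x , nonempty-⊆⁅⁆ nonempty (subst (res 𝒜 (∁ ⁅ x ⁆) ⊆_) resT≡ (res-antitone T⊆∁⁅x⁆))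
      where
        x = proj₁ (¬∀⟶∃¬ _ _ (_∈? T) ¬all∈T)
        x∉T = proj₂ (¬∀⟶∃¬ _ _ (_∈? T) ¬all∈T)
        T⊆∁⁅x⁆ : T ⊆ ∁ ⁅ x ⁆
        T⊆∁⁅x⁆ y∈T = x∉p⇒x∈∁p (x≢y⇒x∉⁅y⁆ λ { refl → x∉T y∈T })
        nonempty : Nonempty (res 𝒜 (∁ ⁅ x ⁆))
        nonempty with nonempty? (res 𝒜 (∁ ⁅ x ⁆))
        ... | yes ne = ne
        ... | no empty = ⊥-elim (x∈∁p⇒x∉p (subst (x ∈_) (sym ∁⁅x⁆≡⊤) ∈⊤) (x∈⁅x⁆ x))
          where
            ∁⁅x⁆≡⊤ : ∁ ⁅ x ⁆ ≡ ⊤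
            ∁⁅x⁆≡⊤ = res-injective (trans (Empty-unique empty) (sym (Empty-unique λ (_ , z∈) → ∉-res-⊤ z∈)))

    private
      σ : Fin (size 𝒜) → Fin (size 𝒜)
      σ z = proj₁ (co-singleton z)

      σ-injective : Injective _≡_ _≡_ σ
      σ-injective {z} {z′} σz≡σz′ = ⁅⁆-injective (begin
        ⁅ z ⁆                ≡⟨ sym (proj₂ (co-singleton z)) ⟩
        res 𝒜 (∁ ⁅ σ z ⁆)    ≡⟨ cong (res 𝒜 ∘ ∁ ∘ ⁅_⁆) σz≡σz′ ⟩
        res 𝒜 (∁ ⁅ σ z′ ⁆)   ≡⟨ proj₂ (co-singleton z′) ⟩
        ⁅ z′ ⁆               ∎)
        where open ≡-Reasoning

      π : Fin (size 𝒜) → Fin (size 𝒜)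
      π x = proj₁ (Fin-injective⇒surjective σ-injective x)

      σπ : ∀ x → σ (π x) ≡ x
      σπ x = proj₂ (Fin-injective⇒surjective σ-injective x)

      res-∁⁅⁆ : ∀ x → res 𝒜 (∁ ⁅ x ⁆) ≡ ⁅ π x ⁆
      res-∁⁅⁆ x = subst (λ y → res 𝒜 (∁ ⁅ y ⁆) ≡ ⁅ π x ⁆) (σπ x) (proj₂ (co-singleton (π x)))

    -- Choose T with res T = σ⁻¹ U.  Then ∁ T ⊆ U by antitonicity, and a proper inclusion would
    -- contradict the claim for the smaller set ∁ T.
    res-∁ : ∀ U → Acc _⊂_ U → res 𝒜 (∁ U) ≡ preimage σ U
    res-∁ U (acc smaller) = begin
      res 𝒜 (∁ U)          ≡⟨ cong (res 𝒜 ∘ ∁) (sym ∁T≡U) ⟩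
      res 𝒜 (∁ (∁ T))      ≡⟨ cong (res 𝒜) (∁-involutive T) ⟩
      res 𝒜 T              ≡⟨ resT≡ ⟩
      preimage σ U         ∎
      where
        open ≡-Reasoning
        T = proj₁ (res-surjective (preimage σ U))
        resT≡ = proj₂ (res-surjective (preimage σ U))
        ∁T⊆U : ∁ T ⊆ U
        ∁T⊆U {y} y∈∁T = subst (_∈ U) (σπ y) (∈-preimage⁻ (subst (π y ∈_) resT≡
          (res-antitone (λ t∈T → x∉p⇒x∈∁p (x≢y⇒x∉⁅y⁆ λ { refl → x∈∁p⇒x∉p y∈∁T t∈T }))
            (subst (π y ∈_) (sym (res-∁⁅⁆ y)) (x∈⁅x⁆ (π y))))))
        U⊆∁T : U ⊆ ∁ T
        U⊆∁T {y} y∈U with y ∈? ∁ T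
        ... | yes y∈∁T = y∈∁T
        ... | no y∉∁T = ⊥-elim (y∉∁T (subst (_∈ ∁ T) (σπ y) (∈-preimage⁻ (subst (π y ∈_) preimages≡
                            (∈-preimage⁺ (subst (_∈ U) (sym (σπ y)) y∈U))))))
          where
            preimages≡ : preimage σ U ≡ preimage σ (∁ T)
            preimages≡ = begin
              preimage σ U          ≡⟨ sym resT≡ ⟩
              res 𝒜 T               ≡⟨ cong (res 𝒜) (sym (∁-involutive T)) ⟩
              res 𝒜 (∁ (∁ T))       ≡⟨ res-∁ (∁ T) (smaller (∁T⊆U , y , y∈U , y∉∁T)) ⟩
              preimage σ (∁ T)      ∎
        ∁T≡U : ∁ T ≡ U
        ∁T≡U = ⊆-antisym ∁T⊆U U⊆∁T

    bijective⇒criterion : Criterion 𝒜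
    bijective⇒criterion = record
      { inhibited           = inhibitors-nonempty
      ; controls            = λ x → π x , controls-π x
      ; controls-unique     = λ c c′ → σ-injective (trans (controller c) (sym (controller c′)))
      ; controller-inhibits = λ {_} {_} {a} c a∈ z∈P → subst (_∈ I a) (controller c) (producer-inhibited a∈ z∈P)
      }
      where
        producer-inhibited : ∀ {a z} → a ∈ₗ reactions 𝒜 → z ∈ P a → σ z ∈ I a
        producer-inhibited {a} a∈ z∈P = ∈-preimage⁻ (subst (_ ∈_) (res-∁ (I a) (⊂-wellFounded (I a)))
          (∈-res⁺ a∈ (λ x∈I → subst (_ ∈_) (sym (∁-involutive (I a))) x∈I) z∈P))
        controller : ∀ {x z} → Controls 𝒜 x z → σ z ≡ x
        controller (a , a∈ , I≡ , z∈P) = x∈⁅y⁆⇒x≡y _ (subst (_ ∈_) I≡ (producer-inhibited a∈ z∈P))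
        controls-π : ∀ x → Controls 𝒜 x (π x)
        controls-π x with ∈-res⁻ 𝒜 (subst (π x ∈_) (sym (res-∁⁅⁆ x)) (x∈⁅x⁆ (π x)))
        ... | a , a∈ , I⊆∁∁ , z∈P =
          a , a∈ , nonempty-⊆⁅⁆ (inhibitors-nonempty a∈) (subst (I a ⊆_) (∁-involutive ⁅ x ⁆) I⊆∁∁) , z∈P

-- Turing machines made of sweeps

record Enumeration (A : Set) : Set where
  field
    card          : ℕ
    index         : A → Fin card
    element       : Fin card → A
    element-index : ∀ a → element (index a) ≡ a

open Enumeration public

enum-Unit : Enumeration Unit
enum-Unit = record { card = 1 ; index = λ _ → fz ; element = λ _ → tt ; element-index = λ _ → refl }

enum-Bool : Enumeration Bool
enum-Bool = record { card = 2 ; index = index′ ; element = element′ ; element-index = λ { false → refl ; true → refl } }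
  where
    index′ : Bool → Fin 2
    index′ false = fz
    index′ true  = fs fz
    element′ : Fin 2 → Bool
    element′ fz     = false
    element′ (fs _) = true

enum-× : ∀ {A B} → Enumeration A → Enumeration B → Enumeration (A × B)
enum-× {A} {B} EA EB = record
  { card = card EA * card EB ; index = index′ ; element = element′ ; element-index = element-index′ }
  where
    index′ : A × B → Fin (card EA * card EB)
    index′ (a , b) = combine (index EA a) (index EB b)
    element′ : Fin (card EA * card EB) → A × B
    element′ i = element EA (proj₁ (remQuot {card EA} (card EB) i)) , element EB (proj₂ (remQuot {card EA} (card EB) i))
    element-index′ : ∀ p → element′ (index′ p) ≡ p
    element-index′ (a , b) = cong₂ _,_
      (trans (cong (element EA ∘′ proj₁) split) (element-index EA a))
      (trans (cong (element EB ∘′ proj₂) split) (element-index EB b))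
      where split = remQuot-combine {card EA} {card EB} (index EA a) (index EB b)

enum-⊎ : ∀ {A B} → Enumeration A → Enumeration B → Enumeration (A ⊎ B)
enum-⊎ {A} {B} EA EB = record
  { card = card EA + card EB ; index = index′ ; element = element′ ; element-index = element-index′ }
  where
    index′ : A ⊎ B → Fin (card EA + card EB)
    index′ (inj₁ a) = index EA a ↑ˡ card EB
    index′ (inj₂ b) = card EA ↑ʳ index EB b
    element′ : Fin (card EA + card EB) → A ⊎ B
    element′ i with splitAt (card EA) i
    ... | inj₁ j = inj₁ (element EA j)
    ... | inj₂ k = inj₂ (element EB k)
    element-index′ : ∀ p → element′ (index′ p) ≡ p
    element-index′ (inj₁ a) rewrite splitAt-↑ˡ (card EA) (index EA a) (card EB) = cong inj₁ (element-index EA a)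
    element-index′ (inj₂ b) rewrite splitAt-↑ʳ (card EA) (card EB) (index EB b) = cong inj₂ (element-index EB b)

enum-retract : ∀ {A B} → Enumeration B → (f : A → B) (g : B → A) → (∀ a → g (f a) ≡ a) → Enumeration A
enum-retract EB f g gf = record
  { card = card EB ; index = index EB ∘′ f ; element = g ∘′ element EB
  ; element-index = λ a → trans (cong g (element-index EB (f a))) (gf a) }

module _ (M : TM) where

  step-right : ∀ σ l h x r {σ′ w} → δ M σ h ≡ (σ′ , w , R') →
               step M ⟨ inj₁ σ , l , h , x ∷ r ⟩ ≡ ⟨ σ′ , w ∷ l , x , r ⟩
  step-right σ l h x r eq rewrite eq = refl

  step-right-end : ∀ σ l h {σ′ w} → δ M σ h ≡ (σ′ , w , R') →
                   step M ⟨ inj₁ σ , l , h , [] ⟩ ≡ ⟨ σ′ , w ∷ l , blank , [] ⟩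
  step-right-end σ l h eq rewrite eq = refl

  step-left : ∀ σ x l h r {σ′ w} → δ M σ h ≡ (σ′ , w , L) →
              step M ⟨ inj₁ σ , x ∷ l , h , r ⟩ ≡ ⟨ σ′ , l , x , w ∷ r ⟩
  step-left σ x l h r eq rewrite eq = refl

  step-left-end : ∀ σ h r {σ′ w} → δ M σ h ≡ (σ′ , w , L) →
                  step M ⟨ inj₁ σ , [] , h , r ⟩ ≡ ⟨ σ′ , [] , blank , w ∷ r ⟩
  step-left-end σ h r eq rewrite eq = refl

  step-stay : ∀ σ l h r {σ′ w} → δ M σ h ≡ (σ′ , w , Stay) →
              step M ⟨ inj₁ σ , l , h , r ⟩ ≡ ⟨ σ′ , l , w , r ⟩
  step-stay σ l h r eq rewrite eq = refl

  step-cong : ∀ σ σ′ l h r → δ M σ h ≡ δ M σ′ h →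
              step M ⟨ inj₁ σ , l , h , r ⟩ ≡ step M ⟨ inj₁ σ′ , l , h , r ⟩
  step-cong σ σ′ l h r eq rewrite eq = refl

  run-+ : ∀ s t c → run M (s + t) c ≡ run M t (run M s c)
  run-+ zero    t c = refl
  run-+ (suc s) t c = run-+ s t (step M c)

  run-suc : ∀ t c → run M (suc t) c ≡ step M (run M t c)
  run-suc zero    c = refl
  run-suc (suc t) c = run-suc t (step M c)

  run-halted : ∀ t (c : Config M) {b} → state c ≡ inj₂ b → state (run M t c) ≡ inj₂ b
  run-halted zero    c eq = eq
  run-halted (suc t) ⟨ inj₂ _ , _ , _ , _ ⟩ eq = run-halted t _ eq

  halted-later : ∀ {s t} c {b} → s ≤ t → state (run M s c) ≡ inj₂ b → state (run M t c) ≡ inj₂ b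
  halted-later {s} {t} c {b} s≤t halted = subst (λ u → state (run M u c) ≡ inj₂ b) (ℕ.m+[n∸m]≡n s≤t)
    (trans (cong state (run-+ s (t ∸ s) c)) (run-halted (t ∸ s) (run M s c) halted))

module SweepMachine
  {Cell Phase Memory : Set}
  (enumCell : Enumeration Cell) (enumPhase : Enumeration Phase) (enumMemory : Enumeration Memory)
  (fromInput : InSym → Cell)
  (transduce : Phase → Memory → Cell → Memory × Cell)
  (conclude : Phase → Memory → Phase ⊎ Bool)
  (fresh : Phase → Memory)
  (start : Phase)
  where

  -- Control state 0 of a TM is its start state; it is the index of `starting`.
  Control : Set
  Control = Unit ⊎ ((Phase × Memory) ⊎ Phase)

  pattern starting      = inj₁ tt
  pattern scanning p s  = inj₂ (inj₁ (p , s))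
  pattern rewinding p   = inj₂ (inj₂ p)

  enumControl : Enumeration Control
  enumControl = enum-⊎ enum-Unit (enum-⊎ (enum-× enumPhase enumMemory) enumPhase)

  Symbol : Set
  Symbol = Sym (card enumCell)

  decode : Symbol → Maybe Cell
  decode fz                     = nothing
  decode (fs fz)                = just (fromInput 𝟎)
  decode (fs (fs fz))           = just (fromInput 𝟏)
  decode (fs (fs (fs fz)))      = just (fromInput ♯)
  decode (fs (fs (fs (fs k))))  = just (element enumCell k)

  cellSymbol : Cell → Symbol
  cellSymbol c = fs (fs (fs (fs (index enumCell c))))

  decode-cellSymbol : ∀ c → decode (cellSymbol c) ≡ just c
  decode-cellSymbol c = cong just (element-index enumCell c)

  decode-embed : ∀ x → decode (embed x) ≡ just (fromInput x)
  decode-embed 𝟎 = refl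
  decode-embed 𝟏 = refl
  decode-embed ♯ = refl

  Action : Set
  Action = State (card (enum-⊎ (enum-× enumPhase enumMemory) enumPhase)) × Symbol × Move

  goto : Control → State (card (enum-⊎ (enum-× enumPhase enumMemory) enumPhase))
  goto c = inj₁ (index enumControl c)

  scanAction : Phase → Memory → Maybe Cell → Symbol → Action
  scanAction p s (just c) h = goto (scanning p (proj₁ (transduce p s c))) , cellSymbol (proj₂ (transduce p s c)) , R'
  scanAction p s nothing h with conclude p s
  ... | inj₁ p′ = goto (rewinding p′) , h , L
  ... | inj₂ b  = inj₂ b , h , Stay

  rewindAction : Phase → Maybe Cell → Symbol → Action
  rewindAction p (just _) h = goto (rewinding p) , h , L
  rewindAction p nothing  h = goto (scanning p (fresh p)) , h , R'

  action : Control → Maybe Cell → Symbol → Action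
  action starting       = scanAction start (fresh start)
  action (scanning p s) = scanAction p s
  action (rewinding p)  = rewindAction p

  machine : TM
  machine = record { q = card (enum-⊎ (enum-× enumPhase enumMemory) enumPhase) ; g = card enumCell
                   ; δ = λ σ h → action (element enumControl σ) (decode h) h }

  δ-goto : ∀ c h → δ machine (index enumControl c) h ≡ action c (decode h) h
  δ-goto c h = cong (λ c′ → action c′ (decode h) h) (element-index enumControl c)

  sweepMemory : Phase → Memory → List Cell → Memory
  sweepMemory p s []       = s
  sweepMemory p s (c ∷ cs) = sweepMemory p (proj₁ (transduce p s c)) cs

  sweepOutput : Phase → Memory → List Cell → List Cell
  sweepOutput p s []       = []
  sweepOutput p s (c ∷ cs) = proj₂ (transduce p s c) ∷ sweepOutput p (proj₁ (transduce p s c)) cs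

  length-sweepOutput : ∀ p s cs → length (sweepOutput p s cs) ≡ length cs
  length-sweepOutput p s []       = refl
  length-sweepOutput p s (c ∷ cs) = cong suc (length-sweepOutput p _ cs)

  mutual
    -- Within k sweeps, the first one in phase p over the cells cs, the machine reaches verdict b.
    ReachesVerdict : ℕ → Phase → List Cell → Bool → Set
    ReachesVerdict zero    p cs b = 𝟘
    ReachesVerdict (suc k) p cs b =
      Continues k (conclude p (sweepMemory p (fresh p) cs)) (sweepOutput p (fresh p) cs) b

    Continues : ℕ → Phase ⊎ Bool → List Cell → Bool → Set
    Continues k (inj₁ p′) cs b = ReachesVerdict k p′ cs b
    Continues k (inj₂ b′) cs b = b′ ≡ b

  Represents : List Symbol → List Cell → Set
  Represents = Pointwise (λ t c → decode t ≡ just c)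

  represents-cells : ∀ cs → Represents (map cellSymbol cs) cs
  represents-cells []       = []
  represents-cells (c ∷ cs) = decode-cellSymbol c ∷ represents-cells cs

  represents-input : ∀ xs → Represents (map embed xs) (map fromInput xs)
  represents-input []       = []
  represents-input (x ∷ xs) = decode-embed x ∷ represents-input xs

  data Border : List Symbol → Set where
    bare    : Border []
    blanked : Border (blank ∷ [])

  scan : ∀ p s t ts c cs → decode t ≡ just c → Represents ts cs → ∀ l rb → Border rb →
    run machine (suc (length ts)) ⟨ goto (scanning p s) , l , t , ts ++ rb ⟩
    ≡ ⟨ goto (scanning p (sweepMemory p s (c ∷ cs))) , map cellSymbol (sweepOutput p s (c ∷ cs)) ʳ++ l , blank , [] ⟩
  scan p s t []        c []        t↦c []         l [] bare    =
    step-right-end machine (index enumControl (scanning p s)) l t (trans (δ-goto (scanning p s) t) (cong (λ m → scanAction p s m t) t↦c))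
  scan p s t []        c []        t↦c []         l _  blanked =
    step-right machine (index enumControl (scanning p s)) l t blank [] (trans (δ-goto (scanning p s) t) (cong (λ m → scanAction p s m t) t↦c))
  scan p s t (t′ ∷ ts) c (c′ ∷ cs) t↦c (t′↦c′ ∷ ts↦cs) l rb border
    rewrite step-right machine (index enumControl (scanning p s)) l t t′ (ts ++ rb)
              (trans (δ-goto (scanning p s) t) (cong (λ m → scanAction p s m t) t↦c))
    = scan p (proj₁ (transduce p s c)) t′ ts c′ cs t′↦c′ ts↦cs _ rb border

  rewind : ∀ p cs c r {l} → Border l →
    run machine (suc (length cs)) ⟨ goto (rewinding p) , map cellSymbol cs ++ l , cellSymbol c , r ⟩
    ≡ ⟨ goto (rewinding p) , [] , blank , map cellSymbol cs ʳ++ (cellSymbol c ∷ r) ⟩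
  rewind p []       c r bare    = step-left-end machine (index enumControl (rewinding p)) (cellSymbol c) r (δ-goto (rewinding p) (cellSymbol c))
  rewind p []       c r blanked = step-left machine (index enumControl (rewinding p)) blank [] (cellSymbol c) r (δ-goto (rewinding p) (cellSymbol c))
  rewind p (d ∷ cs) c r {l} border
    rewrite step-left machine (index enumControl (rewinding p)) (cellSymbol d) (map cellSymbol cs ++ l) (cellSymbol c) r
              (δ-goto (rewinding p) (cellSymbol c))
    = rewind p cs d (cellSymbol c ∷ r) border

  turn : ∀ {p p′ s} → conclude p s ≡ inj₁ p′ →
         δ machine (index enumControl (scanning p s)) blank ≡ (goto (rewinding p′) , blank , L)
  turn {p} {s = s} concluded rewrite δ-goto (scanning p s) blank | concluded = refl

  turn-and-rewind : ∀ {p p′ s} cs {l} → conclude p s ≡ inj₁ p′ → Border l →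
    run machine (suc (length cs)) ⟨ goto (scanning p s) , map cellSymbol cs ++ l , blank , [] ⟩
    ≡ ⟨ goto (rewinding p′) , [] , blank , map cellSymbol cs ʳ++ (blank ∷ []) ⟩
  turn-and-rewind {p} {s = s} [] concluded bare = step-left-end machine (index enumControl (scanning p s)) blank [] (turn concluded)
  turn-and-rewind {p} {s = s} [] concluded blanked = step-left machine (index enumControl (scanning p s)) blank [] blank [] (turn concluded)
  turn-and-rewind {p} {p′} {s} (c ∷ cs) {l} concluded border
    rewrite step-left machine (index enumControl (scanning p s)) (cellSymbol c) (map cellSymbol cs ++ l) blank [] (turn concluded)
    = rewind p′ cs c (blank ∷ []) border

  sweepTime : ℕ → ℕ
  sweepTime n = suc n + suc (suc (suc n))

  sweep-continue : ∀ p t ts c cs {l rb p′} → decode t ≡ just c → Represents ts cs → Border l → Border rb →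
    conclude p (sweepMemory p (fresh p) (c ∷ cs)) ≡ inj₁ p′ →
    run machine (sweepTime (length ts)) ⟨ goto (scanning p (fresh p)) , l , t , ts ++ rb ⟩
    ≡ ⟨ goto (scanning p′ (fresh p′)) , blank ∷ [] , cellSymbol (proj₂ (transduce p (fresh p) c)) ,
        map cellSymbol (sweepOutput p (proj₁ (transduce p (fresh p) c)) cs) ++ blank ∷ [] ⟩
  sweep-continue p t ts c cs {l} {rb} {p′} t↦c ts↦cs border-l border-rb concluded = begin
    run machine (suc n + suc (suc (suc n))) initial-config
      ≡⟨ run-+ machine (suc n) _ initial-config ⟩
    run machine (suc (suc (suc n))) (run machine (suc n) initial-config)
      ≡⟨ cong (run machine (suc (suc (suc n)))) scanned ⟩
    run machine (suc (suc (suc n))) turning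
      ≡⟨ run-suc machine (suc (suc n)) turning ⟩
    step machine (run machine (suc (suc n)) turning)
      ≡⟨ cong (λ k → step machine (run machine (suc k) turning)) length≡ ⟩
    step machine (run machine (suc (length (reverse out))) turning)
      ≡⟨ cong (step machine) (turn-and-rewind (reverse out) concluded border-l) ⟩
    step machine ⟨ goto (rewinding p′) , [] , blank , map cellSymbol (reverse out) ʳ++ (blank ∷ []) ⟩
      ≡⟨ cong (λ right → step machine ⟨ goto (rewinding p′) , [] , blank , right ⟩) right≡ ⟩
    step machine ⟨ goto (rewinding p′) , [] , blank , map cellSymbol out ++ blank ∷ [] ⟩
      ≡⟨ step-right machine (index enumControl (rewinding p′)) [] blank _ _ (δ-goto (rewinding p′) blank) ⟩
    _ ∎
    where
      open ≡-Reasoning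
      n = length ts
      out = sweepOutput p (fresh p) (c ∷ cs)
      initial-config = ⟨ goto (scanning p (fresh p)) , l , t , ts ++ rb ⟩
      turning = ⟨ goto (scanning p (sweepMemory p (fresh p) (c ∷ cs))) , map cellSymbol (reverse out) ++ l , blank , [] ⟩
      scanned : run machine (suc n) initial-config ≡ turning
      scanned = trans (scan p (fresh p) t ts c cs t↦c ts↦cs l rb border-rb)
        (cong (λ left → ⟨ _ , left , blank , [] ⟩)
              (trans (ʳ++-defn (map cellSymbol out)) (cong (_++ l) (sym (reverse-map cellSymbol out)))))
      right≡ : map cellSymbol (reverse out) ʳ++ (blank ∷ []) ≡ map cellSymbol out ++ blank ∷ []
      right≡ = trans (ʳ++-defn (map cellSymbol (reverse out)))
        (cong (_++ blank ∷ []) (trans (cong reverse (reverse-map cellSymbol out)) (reverse-involutive (map cellSymbol out))))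
      length≡ : suc n ≡ length (reverse out)
      length≡ = sym (trans (length-reverse out)
        (trans (length-sweepOutput p (fresh p) (c ∷ cs)) (cong suc (sym (Pointwise-length ts↦cs)))))

  sweep-halt : ∀ p t ts c cs {l rb b} → decode t ≡ just c → Represents ts cs → Border rb →
    conclude p (sweepMemory p (fresh p) (c ∷ cs)) ≡ inj₂ b →
    state (run machine (sweepTime (length ts)) ⟨ goto (scanning p (fresh p)) , l , t , ts ++ rb ⟩) ≡ inj₂ b
  sweep-halt p t ts c cs {l} {rb} {b} t↦c ts↦cs border-rb concluded
    rewrite run-+ machine (suc (length ts)) (suc (suc (suc (length ts)))) ⟨ goto (scanning p (fresh p)) , l , t , ts ++ rb ⟩
          | scan p (fresh p) t ts c cs t↦c ts↦cs l rb border-rb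
    = run-halted machine (suc (suc (length ts))) _
        (cong state (step-stay machine (index enumControl (scanning p final)) _ blank [] halt))
    where
      final = sweepMemory p (fresh p) (c ∷ cs)
      halt : δ machine (index enumControl (scanning p final)) blank ≡ (inj₂ b , blank , Stay)
      halt rewrite δ-goto (scanning p final) blank | concluded = refl

  verdict-run : ∀ k p t ts c cs {l rb b} → decode t ≡ just c → Represents ts cs → Border l → Border rb →
    ReachesVerdict k p (c ∷ cs) b →
    state (run machine (k * sweepTime (length ts)) ⟨ goto (scanning p (fresh p)) , l , t , ts ++ rb ⟩) ≡ inj₂ b
  verdict-run (suc k) p t ts c cs {l} {rb} {b} t↦c ts↦cs border-l border-rb verdict
    rewrite run-+ machine (sweepTime (length ts)) (k * sweepTime (length ts)) ⟨ goto (scanning p (fresh p)) , l , t , ts ++ rb ⟩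
    with conclude p (sweepMemory p (fresh p) (c ∷ cs)) in concluded
  ... | inj₂ _ = run-halted machine (k * sweepTime (length ts)) _
                   (trans (sweep-halt p t ts c cs t↦c ts↦cs border-rb concluded) (cong inj₂ verdict))
  ... | inj₁ p′ rewrite sweep-continue p t ts c cs t↦c ts↦cs border-l border-rb concluded =
    subst (λ n → state (run machine (k * sweepTime n) _) ≡ inj₂ b) length≡
      (verdict-run k p′ (cellSymbol o) (map cellSymbol os) o os (decode-cellSymbol o) (represents-cells os) blanked blanked verdict)
    where
      o = proj₂ (transduce p (fresh p) c)
      os = sweepOutput p (proj₁ (transduce p (fresh p) c)) cs
      length≡ : length (map cellSymbol os) ≡ length ts
      length≡ = trans (length-map cellSymbol os) (trans (length-sweepOutput p _ cs) (sym (Pointwise-length ts↦cs)))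

  start-run : ∀ k x xs {b} → ReachesVerdict k start (map fromInput (x ∷ xs)) b →
    state (run machine (k * sweepTime (length xs)) (initial machine (x ∷ xs))) ≡ inj₂ b
  start-run (suc k) x xs {b} verdict = begin
    state (run machine (suc k * sweepTime n) (initial machine (x ∷ xs)))
      ≡⟨ cong (state ∘′ run machine (pred (suc k * sweepTime n))) first-step ⟩
    state (run machine (suc k * sweepTime n) (scanning-config (map embed xs)))
      ≡⟨ cong₂ (λ m r → state (run machine (suc k * sweepTime m) (scanning-config r)))
               (sym (length-map embed xs)) (sym (++-identityʳ (map embed xs))) ⟩
    state (run machine (suc k * sweepTime (length (map embed xs))) (scanning-config (map embed xs ++ [])))
      ≡⟨ verdict-run (suc k) start (embed x) (map embed xs) (fromInput x) (map fromInput xs)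
                     (decode-embed x) (represents-input xs) bare bare verdict ⟩
    inj₂ b ∎
    where
      open ≡-Reasoning
      n = length xs
      scanning-config : List Symbol → Config machine
      scanning-config r = ⟨ goto (scanning start (fresh start)) , [] , embed x , r ⟩
      first-step : step machine (initial machine (x ∷ xs)) ≡ step machine (scanning-config (map embed xs))
      first-step = step-cong machine fz (index enumControl (scanning start (fresh start))) [] (embed x) (map embed xs)
                     (sym (δ-goto (scanning start (fresh start)) (embed x)))

-- The decision procedure

data Kind : Set where
  bit : Bool → Kind
  sep : Kind

-- The pair (x, z) under inspection lives on the tape: markX (markZ) flags position x (z) of the
-- header and of every inhibitor (product) block.
record Cell : Set where
  constructor cell
  field
    kind        : Kind
    markX markZ : Bool

-- The input 1ⁿ ♯ (R ♯ I ♯ P ♯)* consists of a header block followed by reaction blocks.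
data Block : Set where
  header reactants inhibitors products : Block

-- The number of ones seen in a block, saturated at two.
data Count : Set where
  none one many : Count

-- The flags mean, per phase:
--   initialise : block still fresh, header empty, some inhibitor block empty;
--   check      : inhibitor bit at x, product bit at z, x controls z, every producer of z is inhibited by x;
--   advance    : a mark is pending, the mark fell off the end of its block;
--   resetZ     : block still fresh.
record Memory : Set where
  constructor mem
  field
    block : Block
    count : Count
    flag₁ flag₂ flag₃ flag₄ : Bool

data Phase : Set where
  initialise resetZ advanceX : Phase
  check advanceZ : Bool → Phase

enumKind : Enumeration Kind
enumKind = enum-retract (enum-⊎ enum-Bool enum-Unit) to from from-to
  where
    to : Kind → Bool ⊎ Unit
    to (bit b) = inj₁ b
    to sep     = inj₂ tt
    from : Bool ⊎ Unit → Kind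
    from (inj₁ b) = bit b
    from (inj₂ _) = sep
    from-to : ∀ k → from (to k) ≡ k
    from-to (bit b) = refl
    from-to sep     = refl

enumCell : Enumeration Cell
enumCell = enum-retract (enum-× enumKind (enum-× enum-Bool enum-Bool))
  (λ (cell k x z) → k , x , z) (λ (k , x , z) → cell k x z) (λ _ → refl)

enumBlock : Enumeration Block
enumBlock = enum-retract (enum-× enum-Bool enum-Bool) to from from-to
  where
    to : Block → Bool × Bool
    to header     = false , false
    to reactants  = false , true
    to inhibitors = true , false
    to products   = true , true
    from : Bool × Bool → Block
    from (false , false) = header
    from (false , true)  = reactants
    from (true , false)  = inhibitors
    from (true , true)   = products
    from-to : ∀ b → from (to b) ≡ b
    from-to header     = refl
    from-to reactants  = refl
    from-to inhibitors = refl
    from-to products   = refl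

enumCount : Enumeration Count
enumCount = enum-retract (enum-⊎ enum-Unit enum-Bool) to from from-to
  where
    to : Count → Unit ⊎ Bool
    to none = inj₁ tt
    to one  = inj₂ false
    to many = inj₂ true
    from : Unit ⊎ Bool → Count
    from (inj₁ _)     = none
    from (inj₂ false) = one
    from (inj₂ true)  = many
    from-to : ∀ c → from (to c) ≡ c
    from-to none = refl
    from-to one  = refl
    from-to many = refl

enumMemory : Enumeration Memory
enumMemory = enum-retract (enum-× enumBlock (enum-× enumCount (enum-× enum-Bool (enum-× enum-Bool (enum-× enum-Bool enum-Bool)))))
  (λ (mem b c f₁ f₂ f₃ f₄) → b , c , f₁ , f₂ , f₃ , f₄) (λ (b , c , f₁ , f₂ , f₃ , f₄) → mem b c f₁ f₂ f₃ f₄) (λ _ → refl)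

enumPhase : Enumeration Phase
enumPhase = enum-retract (enum-⊎ enum-Unit (enum-⊎ enum-Unit (enum-⊎ enum-Unit (enum-⊎ enum-Bool enum-Bool)))) to from from-to
  where
    to : Phase → Unit ⊎ (Unit ⊎ (Unit ⊎ (Bool ⊎ Bool)))
    to initialise   = inj₁ tt
    to resetZ       = inj₂ (inj₁ tt)
    to advanceX     = inj₂ (inj₂ (inj₁ tt))
    to (check b)    = inj₂ (inj₂ (inj₂ (inj₁ b)))
    to (advanceZ b) = inj₂ (inj₂ (inj₂ (inj₂ b)))
    from : Unit ⊎ (Unit ⊎ (Unit ⊎ (Bool ⊎ Bool))) → Phase
    from (inj₁ _)                      = initialise
    from (inj₂ (inj₁ _))               = resetZ
    from (inj₂ (inj₂ (inj₁ _)))        = advanceX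
    from (inj₂ (inj₂ (inj₂ (inj₁ b)))) = check b
    from (inj₂ (inj₂ (inj₂ (inj₂ b)))) = advanceZ b
    from-to : ∀ p → from (to p) ≡ p
    from-to initialise   = refl
    from-to resetZ       = refl
    from-to advanceX     = refl
    from-to (check b)    = refl
    from-to (advanceZ b) = refl

fromInput : InSym → Cell
fromInput 𝟎 = cell (bit false) false false
fromInput 𝟏 = cell (bit true) false false
fromInput ♯ = cell sep false false

nextBlock : Block → Block
nextBlock header     = reactants
nextBlock reactants  = inhibitors
nextBlock inhibitors = products
nextBlock products   = reactants

carriesX carriesZ : Block → Bool
carriesX header     = true
carriesX inhibitors = true
carriesX _          = false
carriesZ header   = true
carriesZ products = true
carriesZ _        = false

addBit : Bool → Count → Count
addBit false c    = c
addBit true  none = one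
addBit true  one  = many
addBit true  many = many

isNone isOne : Count → Bool
isNone none = true
isNone _    = false
isOne one = true
isOne _   = false

noteEmptyHeader : Block → Bool → Bool → Bool
noteEmptyHeader header true _ = true
noteEmptyHeader _      _    e = e

noteEmptyInhibitors : Block → Count → Bool → Bool
noteEmptyInhibitors inhibitors c e = e ∨ isNone c
noteEmptyInhibitors _          _ e = e

initialiseStep : Memory → Cell → Memory × Cell
initialiseStep (mem b c fresh empty bad f) (cell sep x z) =
  mem (nextBlock b) none true (noteEmptyHeader b fresh empty) (noteEmptyInhibitors b c bad) f , cell sep x z
initialiseStep (mem b c fresh empty bad f) (cell (bit β) x z) =
  mem b (addBit β c) false empty bad f , cell (bit β) (fresh ∧ carriesX b) (fresh ∧ carriesZ b)

checkStep : Memory → Cell → Memory × Cell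
checkStep (mem products c ix pz ctrl inh) (cell sep x z) =
  mem reactants none false false (ctrl ∨ (isOne c ∧ (ix ∧ pz))) (inh ∧ (not pz ∨ ix)) , cell sep x z
checkStep (mem b c ix pz ctrl inh) (cell sep x z) = mem (nextBlock b) c ix pz ctrl inh , cell sep x z
checkStep (mem inhibitors c ix pz ctrl inh) (cell (bit β) x z) =
  mem inhibitors (addBit β c) (if x then β else ix) pz ctrl inh , cell (bit β) x z
checkStep (mem products c ix pz ctrl inh) (cell (bit β) x z) =
  mem products c ix (if z then β else pz) ctrl inh , cell (bit β) x z
checkStep m (cell (bit β) x z) = m , cell (bit β) x z

advanceZStep : Memory → Cell → Memory × Cell
advanceZStep (mem b c false fell f₃ f₄) (cell sep x z) = mem b c false fell f₃ f₄ , cell sep x z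
advanceZStep (mem b c true  fell f₃ f₄) (cell sep x z) = mem b c false true f₃ f₄ , cell sep x z
advanceZStep (mem b c pending fell f₃ f₄) (cell (bit β) x true)  = mem b c true fell f₃ f₄ , cell (bit β) x false
advanceZStep (mem b c pending fell f₃ f₄) (cell (bit β) x false) = mem b c false fell f₃ f₄ , cell (bit β) x pending

advanceXStep : Memory → Cell → Memory × Cell
advanceXStep (mem b c false fell f₃ f₄) (cell sep x z) = mem b c false fell f₃ f₄ , cell sep x z
advanceXStep (mem b c true  fell f₃ f₄) (cell sep x z) = mem b c false true f₃ f₄ , cell sep x z
advanceXStep (mem b c pending fell f₃ f₄) (cell (bit β) true z)  = mem b c true fell f₃ f₄ , cell (bit β) false z
advanceXStep (mem b c pending fell f₃ f₄) (cell (bit β) false z) = mem b c false fell f₃ f₄ , cell (bit β) pending z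

resetZStep : Memory → Cell → Memory × Cell
resetZStep (mem b c fresh f₂ f₃ f₄) (cell sep x z) = mem (nextBlock b) c true f₂ f₃ f₄ , cell sep x z
resetZStep (mem b c fresh f₂ f₃ f₄) (cell (bit β) x z) = mem b c false f₂ f₃ f₄ , cell (bit β) x (z ∨ (fresh ∧ carriesZ b))

transduce : Phase → Memory → Cell → Memory × Cell
transduce initialise   = initialiseStep
transduce (check _)    = checkStep
transduce (advanceZ _) = advanceZStep
transduce resetZ       = resetZStep
transduce advanceX     = advanceXStep

fresh : Phase → Memory
fresh initialise   = mem header none true false false false
fresh (check _)    = mem header none false false false true
fresh (advanceZ _) = mem header none false false false false
fresh resetZ       = mem header none true false false false
fresh advanceX     = mem header none false false false false

-- The flag of check and advanceZ records whether the current x already controls some z.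
conclude : Phase → Memory → Phase ⊎ Bool
conclude initialise (mem _ _ _ empty bad _) =
  if empty then inj₂ true else if bad then inj₂ false else inj₁ (check false)
conclude (check found) (mem _ _ _ _ ctrl inh) =
  if ctrl ∧ not inh then inj₂ false else if found ∧ ctrl then inj₂ false else inj₁ (advanceZ (found ∨ ctrl))
conclude (advanceZ found) (mem _ _ _ fell _ _) =
  if fell then (if found then inj₁ resetZ else inj₂ false) else inj₁ (check found)
conclude resetZ _ = inj₁ advanceX
conclude advanceX (mem _ _ _ fell _ _) = if fell then inj₂ true else inj₁ (check false)

open SweepMachine enumCell enumPhase enumMemory fromInput transduce conclude fresh initialise

-- A mark at distance k from the start of a block is `just k`; `nothing` means no mark.
markHere : Maybe ℕ → Bool
markHere (just zero) = true
markHere _           = false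

markOnward : Maybe ℕ → Maybe ℕ
markOnward (just (suc k)) = just k
markOnward _              = nothing

block : ∀ {m} → Vec Bool m → Maybe ℕ → Maybe ℕ → List Cell
block []      _  _  = []
block (b ∷ v) mx mz = cell (bit b) (markHere mx) (markHere mz) ∷ block v (markOnward mx) (markOnward mz)

sepCell : Cell
sepCell = cell sep false false

row : ∀ {n} → Maybe ℕ → Maybe ℕ → Reaction n → List Cell
row mx mz a = block (R a) nothing nothing ++ sepCell ∷ block (I a) mx nothing ++ sepCell ∷ block (P a) nothing mz ++ sepCell ∷ []

rows : ∀ {n} → Maybe ℕ → Maybe ℕ → List (Reaction n) → List Cell
rows mx mz []       = []
rows mx mz (a ∷ as) = row mx mz a ++ rows mx mz as

tape : ∀ {n} → List (Reaction n) → Maybe ℕ → Maybe ℕ → List Cell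
tape {n} as mx mz = block (Vec.replicate n true) mx mz ++ sepCell ∷ rows mx mz as

bits-block : ∀ {m} (v : Vec Bool m) → map fromInput (bits v) ≡ block v nothing nothing
bits-block []          = refl
bits-block (true ∷ v)  = cong (_ ∷_) (bits-block v)
bits-block (false ∷ v) = cong (_ ∷_) (bits-block v)

ones-block : ∀ n → map fromInput (replicate n 𝟏) ≡ block (Vec.replicate n true) nothing nothing
ones-block zero    = refl
ones-block (suc n) = cong (_ ∷_) (ones-block n)

encReaction-row : ∀ {n} (a : Reaction n) → map fromInput (encReaction a) ≡ row nothing nothing a
encReaction-row a
  rewrite map-++ fromInput (bits (R a)) (♯ ∷ bits (I a) ++ ♯ ∷ bits (P a) ++ ♯ ∷ [])
        | map-++ fromInput (bits (I a)) (♯ ∷ bits (P a) ++ ♯ ∷ [])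
        | map-++ fromInput (bits (P a)) (♯ ∷ [])
        | bits-block (R a) | bits-block (I a) | bits-block (P a) = refl

encReactions-rows : ∀ {n} (as : List (Reaction n)) → map fromInput (concatMap encReaction as) ≡ rows nothing nothing as
encReactions-rows []       = refl
encReactions-rows (a ∷ as)
  rewrite map-++ fromInput (encReaction a) (concatMap encReaction as) | encReaction-row a | encReactions-rows as = refl

encode-tape : ∀ 𝒜 → map fromInput (encode 𝒜) ≡ tape (reactions 𝒜) nothing nothing
encode-tape (rs n as) rewrite map-++ fromInput (replicate n 𝟏) (♯ ∷ concatMap encReaction as)
                            | ones-block n | encReactions-rows as = refl

data Sweeps (p : Phase) : Memory → List Cell → Memory → List Cell → Set where
  []  : ∀ {s} → Sweeps p s [] s []
  _∷_ : ∀ {s c s₁ c′ cs s₂ os} → transduce p s c ≡ (s₁ , c′) → Sweeps p s₁ cs s₂ os →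
        Sweeps p s (c ∷ cs) s₂ (c′ ∷ os)

infixr 5 _++ₛ_

_++ₛ_ : ∀ {p s xs s₁ o₁ ys s₂ o₂} → Sweeps p s xs s₁ o₁ → Sweeps p s₁ ys s₂ o₂ → Sweeps p s (xs ++ ys) s₂ (o₁ ++ o₂)
[]         ++ₛ τ = τ
(step ∷ σ) ++ₛ τ = step ∷ (σ ++ₛ τ)

sweeps-memory : ∀ {p s cs s′ os} → Sweeps p s cs s′ os → sweepMemory p s cs ≡ s′
sweeps-memory []            = refl
sweeps-memory (refl ∷ σ)    = sweeps-memory σ

sweeps-output : ∀ {p s cs s′ os} → Sweeps p s cs s′ os → sweepOutput p s cs ≡ os
sweeps-output []            = refl
sweeps-output (refl ∷ σ)    = cong (_ ∷_) (sweeps-output σ)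

countBits : ∀ {m} → Vec Bool m → Count → Count
countBits []      c = c
countBits (b ∷ v) c = countBits v (addBit b c)

markIf : Bool → Maybe ℕ
markIf true  = just 0
markIf false = nothing

initialise-unmarked : ∀ {m} (v : Vec Bool m) b c e bad f →
  Sweeps initialise (mem b c false e bad f) (block v nothing nothing) (mem b (countBits v c) false e bad f) (block v nothing nothing)
initialise-unmarked []      b c e bad f = []
initialise-unmarked (β ∷ v) b c e bad f = refl ∷ initialise-unmarked v b (addBit β c) e bad f

initialise-block : ∀ {m} β (v : Vec Bool m) b c e bad f →
  Sweeps initialise (mem b c true e bad f) (block (β ∷ v) nothing nothing)
         (mem b (countBits (β ∷ v) c) false e bad f) (block (β ∷ v) (markIf (carriesX b)) (markIf (carriesZ b)))
initialise-block β v header     c e bad f = refl ∷ initialise-unmarked v header (addBit β c) e bad f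
initialise-block β v reactants  c e bad f = refl ∷ initialise-unmarked v reactants (addBit β c) e bad f
initialise-block β v inhibitors c e bad f = refl ∷ initialise-unmarked v inhibitors (addBit β c) e bad f
initialise-block β v products   c e bad f = refl ∷ initialise-unmarked v products (addBit β c) e bad f

noteEmptyRow : ∀ {n} → Reaction n → Bool → Bool
noteEmptyRow a = noteEmptyInhibitors inhibitors (countBits (I a) none)

initialise-row : ∀ {n} (a : Reaction (suc n)) bad f →
  Sweeps initialise (mem reactants none true false bad f) (row nothing nothing a)
         (mem reactants none true false (noteEmptyRow a bad) f) (row (just 0) (just 0) a)
initialise-row a bad f with R a | I a | P a
... | r ∷ rv | i ∷ iv | p ∷ pv =
  initialise-block r rv reactants none false bad f ++ₛ refl ∷
  initialise-block i iv inhibitors none false bad f ++ₛ refl ∷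
  initialise-block p pv products none false _ f ++ₛ refl ∷ []

someInhibitorsEmpty : ∀ {n} → List (Reaction n) → Bool → Bool
someInhibitorsEmpty as bad = foldl (λ acc a → acc ∨ isNone (countBits (I a) none)) bad as

initialise-rows : ∀ {n} (as : List (Reaction (suc n))) bad f →
  Sweeps initialise (mem reactants none true false bad f) (rows nothing nothing as)
         (mem reactants none true false (someInhibitorsEmpty as bad) f) (rows (just 0) (just 0) as)
initialise-rows []       bad f = []
initialise-rows (a ∷ as) bad f = initialise-row a bad f ++ₛ initialise-rows as _ f

initialise-tape : ∀ {n} (as : List (Reaction (suc n))) →
  Sweeps initialise (fresh initialise) (tape as nothing nothing)
         (mem reactants none true false (someInhibitorsEmpty as false) false) (tape as (just 0) (just 0))
initialise-tape {n} as =
  initialise-block true (Vec.replicate n true) header none false false false ++ₛ refl ∷ initialise-rows as false false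

markedBit : ∀ {m} → Vec Bool m → Maybe ℕ → Bool → Bool
markedBit []      mx o = o
markedBit (b ∷ v) mx o = markedBit v (markOnward mx) (if markHere mx then b else o)

check-header : ∀ found {m} (v : Vec Bool m) mx mz c ix pz ctrl inh →
  Sweeps (check found) (mem header c ix pz ctrl inh) (block v mx mz) (mem header c ix pz ctrl inh) (block v mx mz)
check-header found []      mx mz c ix pz ctrl inh = []
check-header found (β ∷ v) mx mz c ix pz ctrl inh = refl ∷ check-header found v (markOnward mx) (markOnward mz) c ix pz ctrl inh

check-reactants : ∀ found {m} (v : Vec Bool m) c ix pz ctrl inh →
  Sweeps (check found) (mem reactants c ix pz ctrl inh) (block v nothing nothing) (mem reactants c ix pz ctrl inh) (block v nothing nothing)
check-reactants found []      c ix pz ctrl inh = []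
check-reactants found (β ∷ v) c ix pz ctrl inh = refl ∷ check-reactants found v c ix pz ctrl inh

check-inhibitors : ∀ found {m} (v : Vec Bool m) mx c ix pz ctrl inh →
  Sweeps (check found) (mem inhibitors c ix pz ctrl inh) (block v mx nothing)
         (mem inhibitors (countBits v c) (markedBit v mx ix) pz ctrl inh) (block v mx nothing)
check-inhibitors found []      mx c ix pz ctrl inh = []
check-inhibitors found (β ∷ v) mx c ix pz ctrl inh =
  refl ∷ check-inhibitors found v (markOnward mx) (addBit β c) (if markHere mx then β else ix) pz ctrl inh

check-products : ∀ found {m} (v : Vec Bool m) mz c ix pz ctrl inh →
  Sweeps (check found) (mem products c ix pz ctrl inh) (block v nothing mz)
         (mem products c ix (markedBit v mz pz) ctrl inh) (block v nothing mz)
check-products found []      mz c ix pz ctrl inh = []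
check-products found (β ∷ v) mz c ix pz ctrl inh =
  refl ∷ check-products found v (markOnward mz) c ix (if markHere mz then β else pz) ctrl inh

controlBit : ∀ {n} → Maybe ℕ → Maybe ℕ → Reaction n → Bool
controlBit mx mz a = isOne (countBits (I a) none) ∧ (markedBit (I a) mx false ∧ markedBit (P a) mz false)

inhibitedBit : ∀ {n} → Maybe ℕ → Maybe ℕ → Reaction n → Bool
inhibitedBit mx mz a = not (markedBit (P a) mz false) ∨ markedBit (I a) mx false

check-row : ∀ found {n} mx mz (a : Reaction n) ctrl inh →
  Sweeps (check found) (mem reactants none false false ctrl inh) (row mx mz a)
         (mem reactants none false false (ctrl ∨ controlBit mx mz a) (inh ∧ inhibitedBit mx mz a)) (row mx mz a)
check-row found mx mz a ctrl inh =
  check-reactants found (R a) none false false ctrl inh ++ₛ refl ∷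
  check-inhibitors found (I a) mx none false false ctrl inh ++ₛ refl ∷
  check-products found (P a) mz (countBits (I a) none) (markedBit (I a) mx false) false ctrl inh ++ₛ refl ∷ []

anyControls : ∀ {n} → Maybe ℕ → Maybe ℕ → List (Reaction n) → Bool → Bool
anyControls mx mz as ctrl = foldl (λ acc a → acc ∨ controlBit mx mz a) ctrl as

allInhibited : ∀ {n} → Maybe ℕ → Maybe ℕ → List (Reaction n) → Bool → Bool
allInhibited mx mz as inh = foldl (λ acc a → acc ∧ inhibitedBit mx mz a) inh as

check-rows : ∀ found {n} mx mz (as : List (Reaction n)) ctrl inh →
  Sweeps (check found) (mem reactants none false false ctrl inh) (rows mx mz as)
         (mem reactants none false false (anyControls mx mz as ctrl) (allInhibited mx mz as inh)) (rows mx mz as)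
check-rows found mx mz []       ctrl inh = []
check-rows found mx mz (a ∷ as) ctrl inh = check-row found mx mz a ctrl inh ++ₛ check-rows found mx mz as _ _

check-tape : ∀ found {n} (as : List (Reaction n)) mx mz →
  Sweeps (check found) (fresh (check found)) (tape as mx mz)
         (mem reactants none false false (anyControls mx mz as false) (allInhibited mx mz as true)) (tape as mx mz)
check-tape found {n} as mx mz =
  check-header found (Vec.replicate n true) mx mz none false false false true ++ₛ refl ∷ check-rows found mx mz as false true

isEmpty : ∀ {m} → Vec Bool m → Bool
isEmpty {m} _ = m ≡ᵇ 0

advanceZ-unmarked : ∀ found {m} (v : Vec Bool m) mx b c fell f₃ f₄ →
  Sweeps (advanceZ found) (mem b c false fell f₃ f₄) (block v mx nothing) (mem b c false fell f₃ f₄) (block v mx nothing)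
advanceZ-unmarked found []      mx b c fell f₃ f₄ = []
advanceZ-unmarked found (β ∷ v) mx b c fell f₃ f₄ = refl ∷ advanceZ-unmarked found v (markOnward mx) b c fell f₃ f₄

advanceZ-pending : ∀ found {m} (v : Vec Bool m) mx b c fell f₃ f₄ →
  Sweeps (advanceZ found) (mem b c true fell f₃ f₄) (block v mx nothing) (mem b c (isEmpty v) fell f₃ f₄) (block v mx (just 0))
advanceZ-pending found []      mx b c fell f₃ f₄ = []
advanceZ-pending found (β ∷ v) mx b c fell f₃ f₄ = refl ∷ advanceZ-unmarked found v (markOnward mx) b c fell f₃ f₄

-- The pending flag records whether the mark has moved past the end of the block.
advanceZ-block : ∀ found {m} (v : Vec Bool m) mx k b c fell f₃ f₄ →
  Sweeps (advanceZ found) (mem b c false fell f₃ f₄) (block v mx (just k)) (mem b c (m ≡ᵇ suc k) fell f₃ f₄) (block v mx (just (suc k)))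
advanceZ-block found []      mx k       b c fell f₃ f₄ = []
advanceZ-block found (β ∷ v) mx zero    b c fell f₃ f₄ = refl ∷ advanceZ-pending found v (markOnward mx) b c fell f₃ f₄
advanceZ-block found (β ∷ v) mx (suc k) b c fell f₃ f₄ = refl ∷ advanceZ-block found v (markOnward mx) k b c fell f₃ f₄

advanceZ-sep : ∀ found pending fell {fell′} b c f₃ f₄ → pending ∨ fell ≡ fell′ →
  transduce (advanceZ found) (mem b c pending fell f₃ f₄) sepCell ≡ (mem b c false fell′ f₃ f₄ , sepCell)
advanceZ-sep found false fell b c f₃ f₄ refl = refl
advanceZ-sep found true  fell b c f₃ f₄ refl = refl

advanceZ-row : ∀ found {n} mx z (a : Reaction n) →
  Sweeps (advanceZ found) (mem header none false (n ≡ᵇ suc z) false false) (row mx (just z) a)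
         (mem header none false (n ≡ᵇ suc z) false false) (row mx (just (suc z)) a)
advanceZ-row found {n} mx z a =
  advanceZ-unmarked found (R a) nothing header none fell false false ++ₛ refl ∷
  advanceZ-unmarked found (I a) mx header none fell false false ++ₛ refl ∷
  advanceZ-block found (P a) nothing z header none fell false false ++ₛ
  advanceZ-sep found fell fell header none false false (∨-idem fell) ∷ []
  where fell = n ≡ᵇ suc z

advanceZ-rows : ∀ found {n} mx z (as : List (Reaction n)) →
  Sweeps (advanceZ found) (mem header none false (n ≡ᵇ suc z) false false) (rows mx (just z) as)
         (mem header none false (n ≡ᵇ suc z) false false) (rows mx (just (suc z)) as)
advanceZ-rows found mx z []       = []
advanceZ-rows found mx z (a ∷ as) = advanceZ-row found mx z a ++ₛ advanceZ-rows found mx z as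

advanceZ-tape : ∀ found {n} (as : List (Reaction n)) mx z →
  Sweeps (advanceZ found) (fresh (advanceZ found)) (tape as mx (just z))
         (mem header none false (n ≡ᵇ suc z) false false) (tape as mx (just (suc z)))
advanceZ-tape found {n} as mx z =
  advanceZ-block found (Vec.replicate n true) mx z header none false false false ++ₛ
  advanceZ-sep found (n ≡ᵇ suc z) false header none false false (∨-identityʳ _) ∷ advanceZ-rows found mx z as

advanceX-unmarked : ∀ {m} (v : Vec Bool m) mz b c fell f₃ f₄ →
  Sweeps advanceX (mem b c false fell f₃ f₄) (block v nothing mz) (mem b c false fell f₃ f₄) (block v nothing mz)
advanceX-unmarked []      mz b c fell f₃ f₄ = []
advanceX-unmarked (β ∷ v) mz b c fell f₃ f₄ = refl ∷ advanceX-unmarked v (markOnward mz) b c fell f₃ f₄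

advanceX-pending : ∀ {m} (v : Vec Bool m) mz b c fell f₃ f₄ →
  Sweeps advanceX (mem b c true fell f₃ f₄) (block v nothing mz) (mem b c (isEmpty v) fell f₃ f₄) (block v (just 0) mz)
advanceX-pending []      mz b c fell f₃ f₄ = []
advanceX-pending (β ∷ v) mz b c fell f₃ f₄ = refl ∷ advanceX-unmarked v (markOnward mz) b c fell f₃ f₄

advanceX-block : ∀ {m} (v : Vec Bool m) k mz b c fell f₃ f₄ →
  Sweeps advanceX (mem b c false fell f₃ f₄) (block v (just k) mz) (mem b c (m ≡ᵇ suc k) fell f₃ f₄) (block v (just (suc k)) mz)
advanceX-block []      k       mz b c fell f₃ f₄ = []
advanceX-block (β ∷ v) zero    mz b c fell f₃ f₄ = refl ∷ advanceX-pending v (markOnward mz) b c fell f₃ f₄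
advanceX-block (β ∷ v) (suc k) mz b c fell f₃ f₄ = refl ∷ advanceX-block v k (markOnward mz) b c fell f₃ f₄

advanceX-sep : ∀ pending fell {fell′} b c f₃ f₄ → pending ∨ fell ≡ fell′ →
  transduce advanceX (mem b c pending fell f₃ f₄) sepCell ≡ (mem b c false fell′ f₃ f₄ , sepCell)
advanceX-sep false fell b c f₃ f₄ refl = refl
advanceX-sep true  fell b c f₃ f₄ refl = refl

advanceX-row : ∀ {n} x mz (a : Reaction n) →
  Sweeps advanceX (mem header none false (n ≡ᵇ suc x) false false) (row (just x) mz a)
         (mem header none false (n ≡ᵇ suc x) false false) (row (just (suc x)) mz a)
advanceX-row {n} x mz a =
  advanceX-unmarked (R a) nothing header none fell false false ++ₛ refl ∷
  advanceX-block (I a) x nothing header none fell false false ++ₛ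
  advanceX-sep fell fell header none false false (∨-idem fell) ∷
  advanceX-unmarked (P a) mz header none fell false false ++ₛ refl ∷ []
  where fell = n ≡ᵇ suc x

advanceX-rows : ∀ {n} x mz (as : List (Reaction n)) →
  Sweeps advanceX (mem header none false (n ≡ᵇ suc x) false false) (rows (just x) mz as)
         (mem header none false (n ≡ᵇ suc x) false false) (rows (just (suc x)) mz as)
advanceX-rows x mz []       = []
advanceX-rows x mz (a ∷ as) = advanceX-row x mz a ++ₛ advanceX-rows x mz as

advanceX-tape : ∀ {n} (as : List (Reaction n)) x mz →
  Sweeps advanceX (fresh advanceX) (tape as (just x) mz)
         (mem header none false (n ≡ᵇ suc x) false false) (tape as (just (suc x)) mz)
advanceX-tape {n} as x mz =
  advanceX-block (Vec.replicate n true) x mz header none false false false ++ₛ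
  advanceX-sep (n ≡ᵇ suc x) false header none false false (∨-identityʳ _) ∷ advanceX-rows x mz as

resetZ-unmarked : ∀ {m} (v : Vec Bool m) mx b c f₂ f₃ f₄ →
  Sweeps resetZ (mem b c false f₂ f₃ f₄) (block v mx nothing) (mem b c false f₂ f₃ f₄) (block v mx nothing)
resetZ-unmarked []      mx b c f₂ f₃ f₄ = []
resetZ-unmarked (β ∷ v) mx b c f₂ f₃ f₄ = refl ∷ resetZ-unmarked v (markOnward mx) b c f₂ f₃ f₄

resetZ-block : ∀ {m} β (v : Vec Bool m) mx b c f₂ f₃ f₄ →
  Sweeps resetZ (mem b c true f₂ f₃ f₄) (block (β ∷ v) mx nothing)
         (mem b c false f₂ f₃ f₄) (block (β ∷ v) mx (markIf (carriesZ b)))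
resetZ-block β v mx header     c f₂ f₃ f₄ = refl ∷ resetZ-unmarked v (markOnward mx) header c f₂ f₃ f₄
resetZ-block β v mx reactants  c f₂ f₃ f₄ = refl ∷ resetZ-unmarked v (markOnward mx) reactants c f₂ f₃ f₄
resetZ-block β v mx inhibitors c f₂ f₃ f₄ = refl ∷ resetZ-unmarked v (markOnward mx) inhibitors c f₂ f₃ f₄
resetZ-block β v mx products   c f₂ f₃ f₄ = refl ∷ resetZ-unmarked v (markOnward mx) products c f₂ f₃ f₄

resetZ-row : ∀ {n} mx (a : Reaction (suc n)) →
  Sweeps resetZ (mem reactants none true false false false) (row mx nothing a)
         (mem reactants none true false false false) (row mx (just 0) a)
resetZ-row mx a with R a | I a | P a
... | r ∷ rv | i ∷ iv | p ∷ pv =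
  resetZ-block r rv nothing reactants none false false false ++ₛ refl ∷
  resetZ-block i iv mx inhibitors none false false false ++ₛ refl ∷
  resetZ-block p pv nothing products none false false false ++ₛ refl ∷ []

resetZ-rows : ∀ {n} mx (as : List (Reaction (suc n))) →
  Sweeps resetZ (mem reactants none true false false false) (rows mx nothing as)
         (mem reactants none true false false false) (rows mx (just 0) as)
resetZ-rows mx []       = []
resetZ-rows mx (a ∷ as) = resetZ-row mx a ++ₛ resetZ-rows mx as

resetZ-tape : ∀ {n} (as : List (Reaction (suc n))) mx →
  Sweeps resetZ (fresh resetZ) (tape as mx nothing) (mem reactants none true false false false) (tape as mx (just 0))
resetZ-tape {n} as mx = resetZ-block true (Vec.replicate n true) mx header none false false false ++ₛ refl ∷ resetZ-rows mx as

block-mark-beyond : ∀ {m} (v : Vec Bool m) mx k → m ≤ k → block v mx (just k) ≡ block v mx nothing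
block-mark-beyond []      mx k       _         = refl
block-mark-beyond (β ∷ v) mx (suc k) (s≤s m≤k) = cong (_ ∷_) (block-mark-beyond v (markOnward mx) k m≤k)

rows-mark-beyond : ∀ {n} mx (as : List (Reaction n)) → rows mx (just n) as ≡ rows mx nothing as
rows-mark-beyond mx []           = refl
rows-mark-beyond {n} mx (a ∷ as) rewrite block-mark-beyond (P a) nothing n ℕ.≤-refl | rows-mark-beyond mx as = refl

tape-mark-beyond : ∀ {n} (as : List (Reaction n)) mx → tape as mx (just n) ≡ tape as mx nothing
tape-mark-beyond {n} as mx rewrite block-mark-beyond (Vec.replicate n true) mx n ℕ.≤-refl | rows-mark-beyond mx as = refl

verdict-step : ∀ {k p cs s′ os b} → Sweeps p (fresh p) cs s′ os → Continues k (conclude p s′) os b →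
               ReachesVerdict (suc k) p cs b
verdict-step {k} {p} {b = b} σ continues =
  subst₂ (λ s os → Continues k (conclude p s) os b) (sym (sweeps-memory σ)) (sym (sweeps-output σ)) continues

last-position : ∀ z {m} → z + 1 ≡ m → (m ≡ᵇ suc z) ≡ true
last-position zero    refl = refl
last-position (suc z) refl = last-position z refl

not-last-position : ∀ z d {m} → z + suc (suc d) ≡ m → (m ≡ᵇ suc z) ≡ false
not-last-position zero    d refl = refl
not-last-position (suc z) d refl = not-last-position z d refl

module Loops {n′ : ℕ} (as : List (Reaction (suc n′))) where

  n : ℕ
  n = suc n′

  controlsᵇ inhibitedᵇ : ℕ → ℕ → Bool
  controlsᵇ  x z = anyControls (just x) (just z) as false
  inhibitedᵇ x z = allInhibited (just x) (just z) as true

  -- The verdict of checking x against the positions z, …, z + d - 1, where `found` records whether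
  -- x controls an earlier position and `next` is the verdict for the remaining x.
  zVerdict : ℕ → ℕ → ℕ → Bool → Bool → Bool
  zVerdict x z zero    found next = if found then next else false
  zVerdict x z (suc d) found next =
    if controlsᵇ x z ∧ not (inhibitedᵇ x z) then false
    else if found ∧ controlsᵇ x z then false
    else zVerdict x (suc z) d (found ∨ controlsᵇ x z) next

  zSweeps : ℕ → ℕ → ℕ
  zSweeps zero    k = k
  zSweeps (suc d) k = suc (suc (zSweeps d k))

  z-loop : ∀ x d z found {k next} → z + suc d ≡ n → ReachesVerdict k resetZ (tape as (just x) nothing) next →
    ReachesVerdict (zSweeps (suc d) k) (check found) (tape as (just x) (just z)) (zVerdict x z (suc d) found next)
  z-loop x d z found {k} {next} z+d≡n rest =
    verdict-step (check-tape found as (just x) (just z)) (after-check found (controlsᵇ x z) (inhibitedᵇ x z) refl refl)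
    where
      after-advance : ∀ found′ d → z + suc d ≡ n →
        Continues (zSweeps d k) (conclude (advanceZ found′) (mem header none false (n ≡ᵇ suc z) false false))
                  (tape as (just x) (just (suc z))) (zVerdict x (suc z) d found′ next)
      after-advance false zero    z+1≡n rewrite last-position z z+1≡n = refl
      after-advance true  zero    z+1≡n rewrite last-position z z+1≡n =
        subst (λ t → ReachesVerdict k resetZ t next)
              (sym (trans (cong (λ m → tape as (just x) (just m)) (trans (ℕ.+-comm 1 z) z+1≡n)) (tape-mark-beyond as (just x)))) rest
      after-advance found′ (suc d) z+d≡n′ rewrite not-last-position z d z+d≡n′ =
        z-loop x d (suc z) found′ (trans (sym (ℕ.+-suc z (suc d))) z+d≡n′) rest
      advance : ∀ found′ → ReachesVerdict (suc (zSweeps d k)) (advanceZ found′) (tape as (just x) (just z))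
                                          (zVerdict x (suc z) d found′ next)
      advance found′ = verdict-step (advanceZ-tape found′ as (just x) z) (after-advance found′ d z+d≡n)
      after-check : ∀ found ctrl inh → controlsᵇ x z ≡ ctrl → inhibitedᵇ x z ≡ inh →
        Continues (suc (zSweeps d k)) (conclude (check found) (mem reactants none false false ctrl inh))
                  (tape as (just x) (just z)) (zVerdict x z (suc d) found next)
      after-check found true  false eq eq′ rewrite eq | eq′ = refl
      after-check true  true  true  eq eq′ rewrite eq | eq′ = refl
      after-check false true  true  eq eq′ rewrite eq | eq′ = advance true
      after-check true  false _     eq _   rewrite eq = advance true
      after-check false false _     eq _   rewrite eq = advance false

  xVerdict : ℕ → ℕ → Bool
  xVerdict x zero    = true
  xVerdict x (suc d) = zVerdict x 0 n false (xVerdict (suc x) d)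

  xSweeps : ℕ → ℕ
  xSweeps zero    = 0
  xSweeps (suc d) = zSweeps n (suc (suc (xSweeps d)))

  x-loop : ∀ x d → x + suc d ≡ n → ReachesVerdict (xSweeps (suc d)) (check false) (tape as (just x) (just 0)) (xVerdict x (suc d))
  x-loop x d x+d≡n = z-loop x n′ 0 false refl
    (verdict-step (resetZ-tape as (just x)) (verdict-step (advanceX-tape as x (just 0)) (after-advance d x+d≡n)))
    where
      after-advance : ∀ d → x + suc d ≡ n →
        Continues (xSweeps d) (conclude advanceX (mem header none false (n ≡ᵇ suc x) false false))
                  (tape as (just (suc x)) (just 0)) (xVerdict (suc x) d)
      after-advance zero    x+1≡n rewrite last-position x x+1≡n = refl
      after-advance (suc d) x+d≡n′ rewrite not-last-position x d x+d≡n′ = x-loop (suc x) d (trans (sym (ℕ.+-suc x (suc d))) x+d≡n′)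

  answer : Bool
  answer = if someInhibitorsEmpty as false then false else xVerdict 0 n

  reaches-answer : ReachesVerdict (suc (xSweeps n)) initialise (tape as nothing nothing) answer
  reaches-answer = verdict-step (initialise-tape as) (after-initialise (someInhibitorsEmpty as false))
    where
      after-initialise : ∀ bad → Continues (xSweeps n) (conclude initialise (mem reactants none true false bad false))
                                           (tape as (just 0) (just 0)) (if bad then false else xVerdict 0 n)
      after-initialise true  = refl
      after-initialise false = x-loop 0 n′ refl

-- Correctness of the verdict

false≢true : false ≢ true
false≢true ()

∧-true⁻ : ∀ {a b} → a ∧ b ≡ true → a ≡ true × b ≡ true
∧-true⁻ {true} {true} _ = refl , refl

∧-true⁺ : ∀ {a b} → a ≡ true → b ≡ true → a ∧ b ≡ true
∧-true⁺ refl refl = refl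

countBits-many : ∀ {m} (v : Vec Bool m) → countBits v many ≡ many
countBits-many []          = refl
countBits-many (true ∷ v)  = countBits-many v
countBits-many (false ∷ v) = countBits-many v

countBits-⊥ : ∀ {m} c → countBits (⊥ {m}) c ≡ c
countBits-⊥ {zero}  c = refl
countBits-⊥ {suc m} c = countBits-⊥ {m} c

countBits-⁅⁆ : ∀ {m} (x : Fin (suc m)) → countBits ⁅ x ⁆ none ≡ one
countBits-⁅⁆ {m} fz     = countBits-⊥ {m} one
countBits-⁅⁆ {suc m} (fs x) = countBits-⁅⁆ x

no-further-one : ∀ {m} (v : Vec Bool m) → isOne (countBits v one) ≡ true → v ≡ ⊥
no-further-one []          _    = refl
no-further-one (true ∷ v)  one? rewrite countBits-many v with one?
... | ()
no-further-one (false ∷ v) one? = cong (outside ∷_) (no-further-one v one?)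

single-one⇒⁅⁆ : ∀ {m} (v : Vec Bool m) {x} → isOne (countBits v none) ≡ true → x ∈ v → v ≡ ⁅ x ⁆
single-one⇒⁅⁆ (true ∷ v)  one? here       = cong (inside ∷_) (no-further-one v one?)
single-one⇒⁅⁆ (true ∷ v)  one? (there x∈) = ⊥-elim (∉⊥ (subst (_ ∈_) (no-further-one v one?) x∈))
single-one⇒⁅⁆ (false ∷ v) one? (there x∈) = cong (outside ∷_) (single-one⇒⁅⁆ v one? x∈)

addBit-true≢none : ∀ c → addBit true c ≢ none
addBit-true≢none none ()
addBit-true≢none one  ()
addBit-true≢none many ()

countBits-≢none : ∀ {m} (v : Vec Bool m) {c} → c ≢ none → countBits v c ≢ none
countBits-≢none []          c≢none = c≢none
countBits-≢none (false ∷ v) c≢none = countBits-≢none v c≢none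
countBits-≢none (true ∷ v) {c} _   = countBits-≢none v (addBit-true≢none c)

nonempty⇒counted : ∀ {m} (v : Vec Bool m) c → Nonempty v → countBits v c ≢ none
nonempty⇒counted (true ∷ v) c (fz , here)        = countBits-≢none v (addBit-true≢none c)
nonempty⇒counted (b ∷ v)    c (fs x , there x∈) = nonempty⇒counted v (addBit b c) (x , x∈)

markedBit-nothing : ∀ {m} (v : Vec Bool m) o → markedBit v nothing o ≡ o
markedBit-nothing []      o = refl
markedBit-nothing (b ∷ v) o = markedBit-nothing v o

markedBit-lookup : ∀ {m} (v : Vec Bool m) (i : Fin m) o → markedBit v (just (toℕ i)) o ≡ lookup v i
markedBit-lookup (b ∷ v) fz     o = markedBit-nothing v b
markedBit-lookup (b ∷ v) (fs i) o = markedBit-lookup v i o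

module _ {A : Set} (f : A → Bool) where

  foldl-∨ foldl-∧ : Bool → List A → Bool
  foldl-∨ = foldl (λ acc a → acc ∨ f a)
  foldl-∧ = foldl (λ acc a → acc ∧ f a)

  foldl-∨-true : ∀ as → foldl-∨ true as ≡ true
  foldl-∨-true []       = refl
  foldl-∨-true (a ∷ as) = foldl-∨-true as

  foldl-∨-true⁻ : ∀ b as → foldl-∨ b as ≡ true → b ≡ true ⊎ ∃[ a ] a ∈ₗ as × f a ≡ true
  foldl-∨-true⁻ b     []       b≡true = inj₁ b≡true
  foldl-∨-true⁻ b     (a ∷ as) h with foldl-∨-true⁻ (b ∨ f a) as h
  ... | inj₂ (a′ , a′∈ , fa′) = inj₂ (a′ , there a′∈ , fa′)
  ... | inj₁ b∨fa with b
  ...   | true  = inj₁ refl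
  ...   | false = inj₂ (a , here refl , b∨fa)

  foldl-∨-true⁺ : ∀ b {as a} → a ∈ₗ as → f a ≡ true → foldl-∨ b as ≡ true
  foldl-∨-true⁺ true  {a ∷ as} _           _  = foldl-∨-true as
  foldl-∨-true⁺ false {a ∷ as} (here refl) fa rewrite fa = foldl-∨-true as
  foldl-∨-true⁺ false {a ∷ as} (there a′∈) fa = foldl-∨-true⁺ (f a) a′∈ fa

  foldl-∧-true⁻ : ∀ b as → foldl-∧ b as ≡ true → b ≡ true × (∀ {a} → a ∈ₗ as → f a ≡ true)
  foldl-∧-true⁻ b     []       b≡true = b≡true , λ ()
  foldl-∧-true⁻ true  (a ∷ as) h with foldl-∧-true⁻ (f a) as h
  ... | fa , all = refl , λ { (here refl) → fa ; (there a′∈) → all a′∈ }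
  foldl-∧-true⁻ false (a ∷ as) h with () ← proj₁ (foldl-∧-true⁻ false as h)

  foldl-∧-true⁺ : ∀ b as → b ≡ true → (∀ {a} → a ∈ₗ as → f a ≡ true) → foldl-∧ b as ≡ true
  foldl-∧-true⁺ b    []       b≡true _   = b≡true
  foldl-∧-true⁺ true (a ∷ as) _      all = foldl-∧-true⁺ (f a) as (all (here refl)) (all ∘ there)

markedBit-bounded : ∀ {m} (v : Vec Bool m) k → markedBit v (just k) false ≡ true → k < m
markedBit-bounded (b ∷ v) zero    _ = s≤s z≤n
markedBit-bounded (b ∷ v) (suc k) h = s≤s (markedBit-bounded v k h)

≤-split : ∀ {m n} → m ≤ n → n ≡ m ⊎ suc m ≤ n
≤-split m≤n with ℕ.m≤n⇒m<n∨m≡n m≤n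
... | inj₁ m<n = inj₂ m<n
... | inj₂ m≡n = inj₁ (sym m≡n)

module Columns {n′ : ℕ} (as : List (Reaction (suc n′))) (x : ℕ) where

  open Loops as

  Ctrl Inh : ℕ → Set
  Ctrl z = controlsᵇ x z ≡ true
  Inh  z = inhibitedᵇ x z ≡ true

  ctrl-bounded : ∀ {z} → Ctrl z → z < n
  ctrl-bounded {z} ctrl with foldl-∨-true⁻ (controlBit (just x) (just z)) false as ctrl
  ... | inj₂ (a , _ , controlled) =
    markedBit-bounded (P a) z (proj₂ (∧-true⁻ (proj₂ (∧-true⁻ {isOne (countBits (I a) none)} controlled))))

  ctrl-false : ∀ {z} → controlsᵇ x z ≡ false → ¬ Ctrl z
  ctrl-false c≡false = false≢true ∘ trans (sym c≡false)

  Consistent : ℕ → Set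
  Consistent z₀ = ∀ {z} → z₀ ≤ z → Ctrl z → Inh z

  -- The flag says whether x already controls a position before z₀.
  Controlled : Bool → ℕ → Set
  Controlled true  z₀ = ∀ {z} → z₀ ≤ z → ¬ Ctrl z
  Controlled false z₀ = ∃[ z ] z₀ ≤ z × Ctrl z × ∀ {z′} → z₀ ≤ z′ → Ctrl z′ → z′ ≡ z

  consistent-shrink : ∀ {z₀} → Consistent z₀ → Consistent (suc z₀)
  consistent-shrink consistent z₀<z = consistent (ℕ.<⇒≤ z₀<z)

  consistent-grow : ∀ {z₀} → (Ctrl z₀ → Inh z₀) → Consistent (suc z₀) → Consistent z₀
  consistent-grow first rest z₀≤z with ≤-split z₀≤z
  ... | inj₁ refl = first
  ... | inj₂ z₀<z = rest z₀<z

  controlled-skip : ∀ {z₀} found → ¬ Ctrl z₀ → Controlled found (suc z₀) → Controlled found z₀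
  controlled-skip true  ¬ctrl uncontrolled z₀≤z with ≤-split z₀≤z
  ... | inj₁ refl = ¬ctrl
  ... | inj₂ z₀<z = uncontrolled z₀<z
  controlled-skip false ¬ctrl (z , z₀<z , ctrl , unique) = z , ℕ.<⇒≤ z₀<z , ctrl , λ z₀≤z′ ctrl′ →
    [ (λ { refl → ⊥-elim (¬ctrl ctrl′) }) , (λ z₀<z′ → unique z₀<z′ ctrl′) ]′ (≤-split z₀≤z′)

  controlled-unskip : ∀ {z₀} found → ¬ Ctrl z₀ → Controlled found z₀ → Controlled found (suc z₀)
  controlled-unskip true  ¬ctrl uncontrolled z₀<z = uncontrolled (ℕ.<⇒≤ z₀<z)
  controlled-unskip false ¬ctrl (z , z₀≤z , ctrl , unique) =
    z , [ (λ { refl → ⊥-elim (¬ctrl ctrl) }) , (λ z₀<z → z₀<z) ]′ (≤-split z₀≤z) , ctrl ,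
    λ z₀<z′ → unique (ℕ.<⇒≤ z₀<z′)

  controlled-take : ∀ {z₀} → Ctrl z₀ → Controlled true (suc z₀) → Controlled false z₀
  controlled-take {z₀} ctrl uncontrolled = z₀ , ℕ.≤-refl , ctrl , λ z₀≤z′ ctrl′ →
    [ (λ z′≡z₀ → z′≡z₀) , (λ z₀<z′ → ⊥-elim (uncontrolled z₀<z′ ctrl′)) ]′ (≤-split z₀≤z′)

  controlled-untake : ∀ {z₀} → Ctrl z₀ → Controlled false z₀ → Controlled true (suc z₀)
  controlled-untake ctrl (z , _ , _ , unique) z₀<z′ ctrl′ =
    ℕ.<-irrefl (trans (unique ℕ.≤-refl ctrl) (sym (unique (ℕ.<⇒≤ z₀<z′) ctrl′))) z₀<z′

  private
    beyond : ∀ {z₀ z} → z₀ ≡ n → z₀ ≤ z → ¬ Ctrl z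
    beyond refl n≤z ctrl = ℕ.<⇒≱ (ctrl-bounded ctrl) n≤z

  zVerdict-sound : ∀ d z₀ found {next} → z₀ + d ≡ n → zVerdict x z₀ d found next ≡ true →
                   next ≡ true × Consistent z₀ × Controlled found z₀
  zVerdict-sound zero z₀ true z₀+0≡n next≡true =
    next≡true , (λ z₀≤z ctrl → ⊥-elim (beyond z₀≡n z₀≤z ctrl)) , beyond z₀≡n
    where z₀≡n = trans (sym (ℕ.+-identityʳ z₀)) z₀+0≡n
  zVerdict-sound (suc d) z₀ found {next} z₀+d≡n = column found (controlsᵇ x z₀) (inhibitedᵇ x z₀) refl refl
    where
      rest : ∀ found → zVerdict x (suc z₀) d found next ≡ true → next ≡ true × Consistent (suc z₀) × Controlled found (suc z₀)
      rest found = zVerdict-sound d (suc z₀) found (trans (sym (ℕ.+-suc z₀ d)) z₀+d≡n)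
      column : ∀ found c i → controlsᵇ x z₀ ≡ c → inhibitedᵇ x z₀ ≡ i →
             (if c ∧ not i then false else if found ∧ c then false else zVerdict x (suc z₀) d (found ∨ c) next) ≡ true →
             next ≡ true × Consistent z₀ × Controlled found z₀
      column _     true false _ _ ()
      column true  true true  _ _ ()
      column false true true c≡ i≡ h with rest true h
      ... | next≡ , consistent , controlled = next≡ , consistent-grow (λ _ → i≡) consistent , controlled-take c≡ controlled
      column true  false _ c≡ _ h with rest true h
      ... | next≡ , consistent , controlled =
        next≡ , consistent-grow (⊥-elim ∘ ctrl-false c≡) consistent ,
        controlled-skip true (ctrl-false c≡) controlled
      column false false _ c≡ _ h with rest false h
      ... | next≡ , consistent , controlled =
        next≡ , consistent-grow (⊥-elim ∘ ctrl-false c≡) consistent ,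
        controlled-skip false (ctrl-false c≡) controlled

  zVerdict-complete : ∀ d z₀ found {next} → z₀ + d ≡ n → next ≡ true → Consistent z₀ → Controlled found z₀ →
                      zVerdict x z₀ d found next ≡ true
  zVerdict-complete zero    z₀ true  _       next≡ _ _ = next≡
  zVerdict-complete zero    z₀ false z₀+0≡n  _ _ (_ , z₀≤z , ctrl , _) =
    ⊥-elim (beyond (trans (sym (ℕ.+-identityʳ z₀)) z₀+0≡n) z₀≤z ctrl)
  zVerdict-complete (suc d) z₀ found {next} z₀+d≡n next≡ consistent controlled =
    column found (controlsᵇ x z₀) (inhibitedᵇ x z₀) refl refl controlled
    where
      rest : ∀ found → Controlled found (suc z₀) → zVerdict x (suc z₀) d found next ≡ true
      rest found = zVerdict-complete d (suc z₀) found (trans (sym (ℕ.+-suc z₀ d)) z₀+d≡n) next≡ (consistent-shrink consistent)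
      column : ∀ found c i → controlsᵇ x z₀ ≡ c → inhibitedᵇ x z₀ ≡ i → Controlled found z₀ →
             (if c ∧ not i then false else if found ∧ c then false else zVerdict x (suc z₀) d (found ∨ c) next) ≡ true
      column _     true  false c≡ i≡ _ = ⊥-elim (false≢true (trans (sym i≡) (consistent ℕ.≤-refl c≡)))
      column true  true  true  c≡ _ uncontrolled = ⊥-elim (uncontrolled ℕ.≤-refl c≡)
      column false true  true  c≡ _ controlled = rest true (controlled-untake c≡ controlled)
      column true  false _     c≡ _ controlled = rest true (controlled-unskip true (ctrl-false c≡) controlled)
      column false false _     c≡ _ controlled = rest false (controlled-unskip false (ctrl-false c≡) controlled)

module Correctness {n′ : ℕ} (as : List (Reaction (suc n′))) where

  open Loops as

  𝒜 : RS
  𝒜 = rs n as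

  controlBit⇒ : ∀ (x z : Fin n) a → controlBit (just (toℕ x)) (just (toℕ z)) a ≡ true → I a ≡ ⁅ x ⁆ × z ∈ P a
  controlBit⇒ x z a h rewrite markedBit-lookup (I a) x false | markedBit-lookup (P a) z false =
    let one? , bits = ∧-true⁻ {isOne (countBits (I a) none)} h
        x∈I , z∈P = ∧-true⁻ bits
    in single-one⇒⁅⁆ (I a) one? (lookup⇒[]= x (I a) x∈I) , lookup⇒[]= z (P a) z∈P

  controlBit⇐ : ∀ (x z : Fin n) a → I a ≡ ⁅ x ⁆ → z ∈ P a → controlBit (just (toℕ x)) (just (toℕ z)) a ≡ true
  controlBit⇐ x z a I≡ z∈P rewrite markedBit-lookup (I a) x false | markedBit-lookup (P a) z false | I≡ | countBits-⁅⁆ x =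
    ∧-true⁺ ([]=⇒lookup (x∈⁅x⁆ x)) ([]=⇒lookup z∈P)

  controls⇒ : ∀ x z → controlsᵇ (toℕ x) (toℕ z) ≡ true → Controls 𝒜 x z
  controls⇒ x z h with foldl-∨-true⁻ (controlBit (just (toℕ x)) (just (toℕ z))) false as h
  ... | inj₂ (a , a∈ , controlled) = let I≡ , z∈P = controlBit⇒ x z a controlled in a , a∈ , I≡ , z∈P

  controls⇐ : ∀ x z → Controls 𝒜 x z → controlsᵇ (toℕ x) (toℕ z) ≡ true
  controls⇐ x z (a , a∈ , I≡ , z∈P) = foldl-∨-true⁺ _ false a∈ (controlBit⇐ x z a I≡ z∈P)

  ProducersInhibited : Fin n → Fin n → Set
  ProducersInhibited x z = ∀ {a} → a ∈ₗ as → z ∈ P a → x ∈ I a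

  inhibited⇒ : ∀ x z → inhibitedᵇ (toℕ x) (toℕ z) ≡ true → ProducersInhibited x z
  inhibited⇒ x z h {a} a∈ z∈P with proj₂ (foldl-∧-true⁻ (inhibitedBit (just (toℕ x)) (just (toℕ z))) true as h) a∈
  ... | inhibited rewrite markedBit-lookup (I a) x false | markedBit-lookup (P a) z false | []=⇒lookup z∈P =
    lookup⇒[]= x (I a) inhibited

  inhibited⇐ : ∀ x z → ProducersInhibited x z → inhibitedᵇ (toℕ x) (toℕ z) ≡ true
  inhibited⇐ x z producers = foldl-∧-true⁺ _ true as refl λ {a} a∈ → inhibitedBit⇐ a (producers a∈)
    where
      inhibitedBit⇐ : ∀ a → (z ∈ P a → x ∈ I a) → inhibitedBit (just (toℕ x)) (just (toℕ z)) a ≡ true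
      inhibitedBit⇐ a z∈P⇒x∈I rewrite markedBit-lookup (I a) x false | markedBit-lookup (P a) z false
        with lookup (P a) z in pz
      ... | false = refl
      ... | true  = []=⇒lookup (z∈P⇒x∈I (lookup⇒[]= z (P a) pz))

  inhibitors-nonempty⇒ : someInhibitorsEmpty as false ≡ false → ∀ {a} → a ∈ₗ as → Nonempty (I a)
  inhibitors-nonempty⇒ none-empty {a} a∈ with nonempty? (I a)
  ... | yes nonempty = nonempty
  ... | no empty = ⊥-elim (false≢true (trans (sym none-empty)
        (foldl-∨-true⁺ (λ a → isNone (countBits (I a) none)) false a∈ counted-none)))
    where
      counted-none : isNone (countBits (I a) none) ≡ true
      counted-none rewrite Empty-unique empty | countBits-⊥ {suc n′} none = refl

  inhibitors-nonempty⇐ : (∀ {a} → a ∈ₗ as → Nonempty (I a)) → someInhibitorsEmpty as false ≡ false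
  inhibitors-nonempty⇐ nonempty = ¬-not λ some-empty →
    case foldl-∨-true⁻ (λ a → isNone (countBits (I a) none)) false as some-empty of λ where
      (inj₂ (a , a∈ , counted-none)) → nonempty⇒counted (I a) none (nonempty a∈) (isNone⇒none counted-none)
    where
      isNone⇒none : ∀ {c} → isNone c ≡ true → c ≡ none
      isNone⇒none {none} _ = refl

  ColumnOK : ℕ → Set
  ColumnOK x = Columns.Consistent as x 0 × Columns.Controlled as x false 0

  xVerdict-sound : ∀ d x₀ → x₀ + d ≡ n → xVerdict x₀ d ≡ true → ∀ {x} → x₀ ≤ x → x < n → ColumnOK x
  xVerdict-sound zero    x₀ x₀+0≡n _ x₀≤x x<n =
    ⊥-elim (ℕ.<⇒≱ x<n (subst (_≤ _) (trans (sym (ℕ.+-identityʳ x₀)) x₀+0≡n) x₀≤x))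
  xVerdict-sound (suc d) x₀ x₀+d≡n h x₀≤x x<n with Columns.zVerdict-sound as x₀ n 0 false refl h
  ... | rest , column-ok with ≤-split x₀≤x
  ...   | inj₁ refl = column-ok
  ...   | inj₂ x₀<x = xVerdict-sound d (suc x₀) (trans (sym (ℕ.+-suc x₀ d)) x₀+d≡n) rest x₀<x x<n

  xVerdict-complete : ∀ d x₀ → x₀ + d ≡ n → (∀ {x} → x₀ ≤ x → x < n → ColumnOK x) → xVerdict x₀ d ≡ true
  xVerdict-complete zero    x₀ _      _  = refl
  xVerdict-complete (suc d) x₀ x₀+d≡n ok =
    let consistent , controlled = ok ℕ.≤-refl (subst (x₀ <_) x₀+d≡n (ℕ.m<m+n x₀ (s≤s z≤n))) in
    Columns.zVerdict-complete as x₀ n 0 false refl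
      (xVerdict-complete d (suc x₀) (trans (sym (ℕ.+-suc x₀ d)) x₀+d≡n) (λ x₀<x → ok (ℕ.<⇒≤ x₀<x)))
      consistent controlled

  ctrl⇒controls : ∀ (x : Fin n) {z} (z<n : z < n) → Columns.Ctrl as (toℕ x) z → Controls 𝒜 x (fromℕ< z<n)
  ctrl⇒controls x z<n ctrl = controls⇒ x _ (subst (λ k → controlsᵇ (toℕ x) k ≡ true) (sym (toℕ-fromℕ< z<n)) ctrl)

  answer-sound : answer ≡ true → Criterion 𝒜
  answer-sound = sound (someInhibitorsEmpty as false) refl
    where
      sound : ∀ b → someInhibitorsEmpty as false ≡ b → (if b then false else xVerdict 0 n) ≡ true → Criterion 𝒜
      sound false none-empty verdict = record
        { inhibited           = inhibitors-nonempty⇒ none-empty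
        ; controls            = λ x → let z , _ , ctrl , _ = controlled x in _ , ctrl⇒controls x (Columns.ctrl-bounded as _ ctrl) ctrl
        ; controls-unique     = λ {x} c c′ → toℕ-injective (trans (unique x (controls⇐ _ _ c)) (sym (unique x (controls⇐ _ _ c′))))
        ; controller-inhibits = λ {x} {z} c a∈ z∈P → inhibited⇒ x z (proj₁ (ok x) z≤n (controls⇐ x z c)) a∈ z∈P
        }
        where
          ok : ∀ (x : Fin n) → ColumnOK (toℕ x)
          ok x = xVerdict-sound n 0 refl verdict z≤n (toℕ<n x)
          controlled : ∀ x → Columns.Controlled as (toℕ x) false 0
          controlled x = proj₂ (ok x)
          unique : ∀ x {z′} → Columns.Ctrl as (toℕ x) z′ → z′ ≡ proj₁ (controlled x)
          unique x = proj₂ (proj₂ (proj₂ (controlled x))) z≤n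

  answer-complete : Criterion 𝒜 → answer ≡ true
  answer-complete criterion rewrite inhibitors-nonempty⇐ (Criterion.inhibited criterion) =
    xVerdict-complete n 0 refl λ {x} _ x<n → subst ColumnOK (toℕ-fromℕ< x<n) (column-ok (fromℕ< x<n))
    where
      open Criterion criterion
      column-ok : ∀ x → ColumnOK (toℕ x)
      column-ok x =
        (λ {z} _ ctrl → let z<n = Columns.ctrl-bounded as _ ctrl in
           subst (λ k → inhibitedᵇ (toℕ x) k ≡ true) (toℕ-fromℕ< z<n)
                 (inhibited⇐ x _ (controller-inhibits (ctrl⇒controls x z<n ctrl)))) ,
        (toℕ (proj₁ (controls x)) , z≤n , controls⇐ x _ (proj₂ (controls x)) ,
         λ {z′} _ ctrl′ → let z′<n = Columns.ctrl-bounded as _ ctrl′ in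
           trans (sym (toℕ-fromℕ< z′<n)) (cong toℕ (controls-unique (ctrl⇒controls x z′<n ctrl′) (proj₂ (controls x)))))

-- Running time and the theorem

module _ {n′ : ℕ} (as : List (Reaction (suc n′))) where
  open Loops as

  zSweeps-≡ : ∀ d k → zSweeps d k ≡ d + d + k
  zSweeps-≡ zero    k = refl
  zSweeps-≡ (suc d) k rewrite zSweeps-≡ d k = ring d k
    where
      ring : ∀ d k → suc (suc (d + d + k)) ≡ suc d + suc d + k
      ring = solve-∀

  xSweeps-≡ : ∀ d → xSweeps d ≡ d * (n + n + 2)
  xSweeps-≡ zero    = refl
  xSweeps-≡ (suc d) rewrite zSweeps-≡ n (suc (suc (xSweeps d))) | xSweeps-≡ d =
    ring n (d * (n + n + 2))
    where
      ring : ∀ n q → n + n + suc (suc q) ≡ n + n + 2 + q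
      ring = solve-∀

-- Over S = ∅ there are no reactions (products are nonempty), and the machine accepts at the empty header.
verdict : RS → Bool
verdict (rs zero    _)  = true
verdict (rs (suc _) as) = Loops.answer as

sweeps : RS → ℕ
sweeps (rs zero    _)  = 1
sweeps (rs (suc n′) as) = suc (Loops.xSweeps as (suc n′))

reaches-verdict : ∀ 𝒜 → ReachesVerdict (sweeps 𝒜) initialise (map fromInput (encode 𝒜)) (verdict 𝒜)
reaches-verdict (rs zero [])          = refl
reaches-verdict (rs zero (a ∷ _))     with () , _ ← P-nonempty a
reaches-verdict 𝒜@(rs (suc n′) as) =
  subst (λ cs → ReachesVerdict (sweeps 𝒜) initialise cs (Loops.answer as)) (sym (encode-tape 𝒜)) (Loops.reaches-answer as)

runningTime : RS → ℕ
runningTime 𝒜 = sweeps 𝒜 * sweepTime (pred (length (encode 𝒜)))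

halts : ∀ 𝒜 → HaltsWithin machine (encode 𝒜) (runningTime 𝒜) (verdict 𝒜)
halts 𝒜@(rs zero    as) = start-run (sweeps 𝒜) ♯ (concatMap encReaction as) (reaches-verdict 𝒜)
halts 𝒜@(rs (suc n′) as) = start-run (sweeps 𝒜) 𝟏 (replicate n′ 𝟏 ++ ♯ ∷ concatMap encReaction as) (reaches-verdict 𝒜)

sweeps-≡ : ∀ 𝒜 → sweeps 𝒜 ≡ suc (size 𝒜 * (size 𝒜 + size 𝒜 + 2))
sweeps-≡ (rs zero     as) = refl
sweeps-≡ (rs (suc n′) as) = cong suc (xSweeps-≡ as (suc n′))

length-encode : ∀ 𝒜 → length (encode 𝒜) ≡ suc (pred (length (encode 𝒜)))
length-encode (rs zero     as) = refl
length-encode (rs (suc n′) as) = refl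

size≤ : ∀ 𝒜 → size 𝒜 ≤ pred (length (encode 𝒜))
size≤ (rs zero     as) = z≤n
size≤ (rs (suc n′) as) = begin
  suc n′                                               ≤⟨ s≤s (ℕ.m≤m+n n′ _) ⟩
  suc (n′ + length (concatMap encReaction as))         ≡⟨ sym (ℕ.+-suc n′ _) ⟩
  n′ + length (♯ ∷ concatMap encReaction as)           ≡⟨ cong (_+ length (♯ ∷ concatMap encReaction as)) (sym (length-replicate n′)) ⟩
  length (replicate n′ 𝟏) + length (♯ ∷ concatMap encReaction as) ≡⟨ sym (length-++ (replicate n′ 𝟏)) ⟩
  length (replicate n′ 𝟏 ++ ♯ ∷ concatMap encReaction as) ∎
  where open ℕ.≤-Reasoning

cubic-bound : ∀ {n m} → n ≤ m → suc (n * (n + n + 2)) * sweepTime m ≤ 32 * suc m ^ 3 + 32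
cubic-bound {n} {m} n≤m = begin
  suc (n * (n + n + 2)) * sweepTime m
    ≤⟨ ℕ.*-monoˡ-≤ (sweepTime m) (s≤s (ℕ.*-mono-≤ n≤m (ℕ.+-monoˡ-≤ 2 (ℕ.+-mono-≤ n≤m n≤m)))) ⟩
  suc (m * (m + m + 2)) * sweepTime m
    ≤⟨ ℕ.m≤m+n _ (28 * (m * (m * m)) + 84 * (m * m) + 86 * m + 60) ⟩
  suc (m * (m + m + 2)) * sweepTime m + (28 * (m * (m * m)) + 84 * (m * m) + 86 * m + 60)
    ≡⟨ ring m ⟩
  32 * suc m ^ 3 + 32 ∎
  where
    open ℕ.≤-Reasoning
    ring : ∀ m → suc (m * (m + m + 2)) * (suc m + suc (suc (suc m))) + (28 * (m * (m * m)) + 84 * (m * m) + 86 * m + 60)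
                 ≡ 32 * (suc m * (suc m * (suc m * 1))) + 32
    ring = solve-∀

runningTime-bound : ∀ 𝒜 → runningTime 𝒜 ≤ 32 * length (encode 𝒜) ^ 3 + 32
runningTime-bound 𝒜 = begin
  sweeps 𝒜 * sweepTime m                       ≡⟨ cong (_* sweepTime m) (sweeps-≡ 𝒜) ⟩
  suc (size 𝒜 * (size 𝒜 + size 𝒜 + 2)) * sweepTime m ≤⟨ cubic-bound (size≤ 𝒜) ⟩
  32 * suc m ^ 3 + 32                          ≡⟨ cong (λ l → 32 * l ^ 3 + 32) (length-encode 𝒜) ⟨
  32 * length (encode 𝒜) ^ 3 + 32 ∎
  where
    open ℕ.≤-Reasoning
    m = pred (length (encode 𝒜))

Subset0-unique : (T T′ : Subset 0) → T ≡ T′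
Subset0-unique [] [] = refl

verdict-sound : ∀ 𝒜 → Reactantless 𝒜 → verdict 𝒜 ≡ true → ResBijective 𝒜
verdict-sound 𝒜@(rs zero   as) _            _ =
  (λ {T} {T′} _ → Subset0-unique T T′) , λ V → [] , λ {T} _ → Subset0-unique (res 𝒜 T) V
verdict-sound (rs (suc n′) as) reactantless   = criterion⇒bijective reactantless ∘ Correctness.answer-sound as

verdict-complete : ∀ 𝒜 → Reactantless 𝒜 → ResBijective 𝒜 → verdict 𝒜 ≡ true
verdict-complete (rs zero     as) _            _ = refl
verdict-complete (rs (suc n′) as) reactantless   = Correctness.answer-complete as ∘ bijective⇒criterion reactantless

corollary19 : PolyTimeDecidable Reactantless ResBijective
corollary19 = machine , 32 , 3 , λ 𝒜 reactantless →
  verdict 𝒜 ,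
  halted-later machine (initial machine (encode 𝒜)) (runningTime-bound 𝒜) (halts 𝒜) ,
  verdict-sound 𝒜 reactantless ,
  verdict-complete 𝒜 reactantless
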